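{- For every integer $n\ge 2$, \[ C(W_n)= 2^{n-1}-n+2+ \sum_{\substack{d\mid n-1\\ d>1}} d \sum_{(a_1,\ldots,a_k)} \Big(\prod_{i=1}^k C(P_{a_i-1})\Big)^{(n-1)/d}, \] where the inner sum runs over all Lyndon compositions $(a_1,\dots,a_k)$ of $d$.
   Context: For a finite labelled graph $G$, a composition of $G$ is a partition of the vertex set $V(G)$ into nonempty blocks such that each block induces a connected subgraph of $G$. $C(G)$ denotes the number of distinct compositions of $G$. $P_m$ is the path on $m$ vertices, so $C(P_m)=2^{m-1}$ for $m\ge1$, and by convention $C(P_0)=1$. The wheel graph $W_n$ (for $n\ge 4$) consists of a cycle $C_{n-1}$ on $n-1$ outer vertices together with one additional central vertex adjacent to every outer vertex; by convention $W_2$ is the path $P_2$ and $W_3$ is the triangle $C_3$. A composition of a positive integer $d$ is an ordered tuple $(a_1,\dots,a_k)$ of positive integers with $a_1+\dots+a_k=d$. A Lyndon composition of $d$ is a composition that is aperiodic (not equal to a concatenation of two or more copies of a shorter tuple) and is lexicographically strictly least among all its cyclic rotations $(a_j,\dots,a_k,a_1,\dots,a_{j-1})$. -}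

module Defs where

open import Data.Nat using (ℕ; zero; suc; _+_; _*_; _∸_; _^_; _≤_; _<_)
open import Data.Fin using (Fin; toℕ)
import Data.Fin as F
open import Data.Vec using (Vec; lookup)
open import Data.Nat.ListAction using (sum; product)
open import Data.List using (List; []; _∷_; length; map; concat; replicate; take; drop; _++_)
open import Data.List.Relation.Unary.All using (All)
open import Data.List.Relation.Unary.Unique.Propositional using (Unique)
open import Data.List.Membership.Propositional using (_∈_)
open import Data.List.Relation.Binary.Lex.Strict using (Lex-<)
open import Data.Product using (Σ; _×_; _,_)
open import Data.Sum using (_⊎_)
open import Relation.Binary.PropositionalEquality using (_≡_; _≢_)
open import Relation.Nullary using (¬_)
open import Function.Bundles using (_⇔_)

SumOver : {A : Set} → (A → Set) → (A → ℕ) → ℕ → Set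
SumOver {A} P f s =
  Σ (List A) λ L → Unique L × (∀ x → (x ∈ L) ⇔ P x) × sum (map f L) ≡ s

HasCount : {A : Set} → (A → Set) → ℕ → Set
HasCount P k = SumOver P (λ _ → 1) k

data Walk {n : ℕ} (Adj : Fin n → Fin n → Set) (S : Fin n → Set)
          : Fin n → Fin n → Set where
  here : ∀ {i} → S i → Walk Adj S i i
  step : ∀ {i j k} → S i → Adj i j → Walk Adj S j k → Walk Adj S i k

-- A set partition of Fin n is encoded canonically by v : Vec (Fin n) n,
-- where  lookup v i  is the least element of the block containing i.
-- (The blocks are the fibres of v; this is a bijection between such
-- vectors and set partitions of Fin n.)
IsPartitionCode : (n : ℕ) → Vec (Fin n) n → Set
IsPartitionCode n v =
  ∀ i → (lookup v i F.≤ i) × (lookup v (lookup v i) ≡ lookup v i)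

-- A composition of the graph: a partition every block of which induces a
-- connected subgraph (any two vertices of a block are joined by a walk
-- inside the block).
IsComposition : (n : ℕ) → (Fin n → Fin n → Set) → Vec (Fin n) n → Set
IsComposition n Adj v =
  IsPartitionCode n v ×
  (∀ i j → lookup v i ≡ lookup v j →
     Walk Adj (λ x → lookup v x ≡ lookup v i) i j)

-- The wheel W_n on vertex set Fin n: vertex 0 is the centre, vertices
-- 1, …, n-1 form the rim cycle 1 - 2 - … - (n-1) - 1.
-- For n = 2 this is P_2, for n = 3 it is the triangle C_3.

WheelAdjℕ : ℕ → ℕ → ℕ → Set
WheelAdjℕ n a b =
  (a ≡ 0 × b ≢ 0) ⊎ (b ≡ 0 × a ≢ 0) ⊎
  (a ≢ 0 × b ≡ suc a) ⊎ (b ≢ 0 × a ≡ suc b) ⊎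
  (a ≡ 1 × b ≡ n ∸ 1 × a ≢ b) ⊎ (b ≡ 1 × a ≡ n ∸ 1 × a ≢ b)

WheelAdj : (n : ℕ) → Fin n → Fin n → Set
WheelAdj n i j = WheelAdjℕ n (toℕ i) (toℕ j)

CP : ℕ → ℕ
CP zero    = 1
CP (suc m) = 2 ^ m

rotate : ℕ → List ℕ → List ℕ
rotate j a = drop j a ++ take j a

_<lex_ : List ℕ → List ℕ → Set
_<lex_ = Lex-< _≡_ _<_

IsLyndonComposition : ℕ → List ℕ → Set
IsLyndonComposition d a =
  All (λ x → 1 ≤ x) a ×
  sum a ≡ d ×
  ¬ (Σ (List ℕ) λ b → Σ ℕ λ k →
       length b < length a × 2 ≤ k × a ≡ concat (replicate k b)) ×
  (∀ j → 0 < j → j < length a → a <lex rotate j a)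

module Submission where

-- Record a composition of W_(m+1) by labelling each rim vertex C (in the block of the centre),
-- S (in the block of its predecessor) or N (starting a new block).  The words that occur are those
-- in which no C is cyclically followed by S and, when there is no C, the number of N is not 1;
-- without C there are 2^m - m of them.  A word containing C, rotated to end in C, splits into
-- gaps (empty or starting with N) whose sizes, counting the C, form a composition a of m, with
-- C(P_(a_i - 1)) choices for the i-th gap and a_1 admissible rotations: Σ_a a_1 ∏ C(P_(a_i - 1)).
-- Every composition is uniquely a rotation of ℓ^(m/d) for a Lyndon composition ℓ of some d ∣ m,
-- and the first entries of the rotations of ℓ sum to d; the term d = 1, ℓ = (1) contributes 1.

module FiniteSums where

  open import Data.Nat using (ℕ; suc; _+_; _*_; _<_; _∸_)
  open import Data.Nat.Properties using (m+n∸m≡n; +-suc; *-zeroʳ; *-distribˡ-+)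
  open import Data.List using (List; []; _∷_; _++_; map; length; upTo; filter)
  open import Data.List.Properties using (map-++; map-∘; map-cong-local; length-upTo)
  open import Data.List.Relation.Unary.All as All using (All; []; _∷_)
  import Data.List.Relation.Unary.All.Properties as All
  open import Data.List.Relation.Unary.Any using (here; there)
  open import Data.List.Relation.Unary.Unique.Propositional using (Unique; []; _∷_)
  import Data.List.Relation.Unary.Unique.Propositional.Properties as Unique
  open import Data.List.Membership.Propositional using (_∈_)
  open import Data.List.Membership.Propositional.Properties using (∈-map⁺; ∈-map⁻; ∈-++⁺ˡ; ∈-++⁺ʳ; ∈-++⁻; ∈-upTo⁺; ∈-upTo⁻; ∈-filter⁺; ∈-filter⁻)
  open import Data.List.Membership.Propositional.Properties.WithK using (unique∧set⇒bag)
  open import Data.List.Relation.Binary.BagAndSetEquality using (∼bag⇒↭)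
  import Data.List.Relation.Binary.Permutation.Propositional.Properties as ↭
  open import Data.Nat.ListAction using (sum)
  open import Data.Nat.ListAction.Properties using (sum-++; sum-↭)
  open import Data.Product using (Σ; _×_; _,_; proj₁; proj₂; uncurry)
  open import Data.Sum using (_⊎_; inj₁; inj₂; [_,_]′)
  open import Data.Empty using (⊥)
  open import Function using (_∘_)
  open import Function.Bundles using (_⇔_; mk⇔; Equivalence)
  open import Relation.Nullary using (¬_; yes; no)
  open import Relation.Nullary.Decidable using (¬?)
  open import Relation.Unary using (Decidable)
  open import Relation.Binary.PropositionalEquality
  open import Defs using (SumOver; HasCount)

  open Equivalence using (to; from)

  private
    variable
      A B : Set

  sum-map-* : (c : ℕ) (f : A → ℕ) (xs : List A) → sum (map (λ x → c * f x) xs) ≡ c * sum (map f xs)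
  sum-map-* c f []       = sym (*-zeroʳ c)
  sum-map-* c f (x ∷ xs) = trans (cong (c * f x +_) (sum-map-* c f xs)) (sym (*-distribˡ-+ c (f x) _))

  sum-map-const-1 : (xs : List A) → sum (map (λ _ → 1) xs) ≡ length xs
  sum-map-const-1 []       = refl
  sum-map-const-1 (x ∷ xs) = cong suc (sum-map-const-1 xs)

  map⁺-Unique-local : (φ : A → B) {xs : List A} →
    (∀ {x y} → x ∈ xs → y ∈ xs → φ x ≡ φ y → x ≡ y) → Unique xs → Unique (map φ xs)
  map⁺-Unique-local φ inj [] = []
  map⁺-Unique-local φ inj (x∉ ∷ u) =
    All.map⁺ (All.tabulate λ y∈ eq → All.lookup x∉ y∈ (inj (here refl) (there y∈) eq)) ∷
    map⁺-Unique-local φ (λ x∈ y∈ → inj (there x∈) (there y∈)) u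

  sumOver-upTo : ∀ n (f : ℕ → ℕ) → SumOver (_< n) f (sum (map f (upTo n)))
  sumOver-upTo n f = upTo n , Unique.upTo⁺ n , (λ _ → mk⇔ ∈-upTo⁻ ∈-upTo⁺) , refl

  count-< : ∀ n → HasCount (_< n) n
  count-< n = subst (HasCount (_< n)) (trans (sum-map-const-1 (upTo n)) (length-upTo n)) (sumOver-upTo n (λ _ → 1))

  module _ {P : A → Set} {f : A → ℕ} where

    sumOver-unique : ∀ {s s′} → SumOver P f s → SumOver P f s′ → s ≡ s′
    sumOver-unique (L , uL , hL , refl) (M , uM , hM , refl) =
      sum-↭ (↭.map⁺ f (∼bag⇒↭ (unique∧set⇒bag uL uM
        (mk⇔ (from (hM _) ∘ to (hL _)) (from (hL _) ∘ to (hM _))))))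

    sumOver-cong : ∀ {Q : A → Set} {s} → (∀ {x} → P x → Q x) → (∀ {x} → Q x → P x) →
                   SumOver P f s → SumOver Q f s
    sumOver-cong P⇒Q Q⇒P (L , uL , hL , eL) =
      L , uL , (λ x → mk⇔ (P⇒Q ∘ to (hL x)) (from (hL x) ∘ Q⇒P)) , eL

    sumOver-congᶠ : ∀ {g : A → ℕ} {s} → (∀ {x} → P x → f x ≡ g x) → SumOver P f s → SumOver P g s
    sumOver-congᶠ f≡g (L , uL , hL , eL) =
      L , uL , hL , trans (cong sum (sym (map-cong-local (All.tabulate (f≡g ∘ to (hL _)))))) eL

    sumOver-*ˡ : ∀ {s} (c : ℕ) → SumOver P f s → SumOver P (λ x → c * f x) (c * s)
    sumOver-*ˡ c (L , uL , hL , eL) = L , uL , hL , trans (sum-map-* c f L) (cong (c *_) eL)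

    sumOver-insert : ∀ {s} (x : A) → ¬ P x → SumOver P f s → SumOver (λ y → y ≡ x ⊎ P y) f (f x + s)
    sumOver-insert x ¬Px (L , uL , hL , eL) =
      x ∷ L , (All.tabulate (λ {y} y∈ x≡y → ¬Px (subst P (sym x≡y) (to (hL y) y∈))) ∷ uL) ,
      (λ y → mk⇔ (λ { (here refl) → inj₁ refl ; (there y∈) → inj₂ (to (hL y) y∈) })
                 (λ { (inj₁ refl) → here refl ; (inj₂ Py) → there (from (hL y) Py) })) ,
      cong (f x +_) eL

    sumOver-⊎ : ∀ {Q : A → Set} {s s′} → (∀ {x} → P x → Q x → ⊥) →
                SumOver P f s → SumOver Q f s′ → SumOver (λ x → P x ⊎ Q x) f (s + s′)
    sumOver-⊎ disjoint (L , uL , hL , eL) (M , uM , hM , eM) =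
      L ++ M , Unique.++⁺ uL uM (λ (x∈L , x∈M) → disjoint (to (hL _) x∈L) (to (hM _) x∈M)) ,
      (λ x → mk⇔ ([ inj₁ ∘ to (hL x) , inj₂ ∘ to (hM x) ]′ ∘ ∈-++⁻ L)
                 [ ∈-++⁺ˡ ∘ from (hL x) , ∈-++⁺ʳ L ∘ from (hM x) ]′) ,
      trans (cong sum (map-++ f L M)) (trans (sum-++ (map f L) (map f M)) (cong₂ _+_ eL eM))

  sumOver-image : {P : A → Set} {f : B → ℕ} {s : ℕ} (φ : A → B) →
                  (∀ {x y} → P x → P y → φ x ≡ φ y → x ≡ y) →
                  SumOver P (f ∘ φ) s → SumOver (λ b → Σ A λ a → P a × φ a ≡ b) f s
  sumOver-image {f = f} φ inj (L , uL , hL , eL) =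
    map φ L , map⁺-Unique-local φ (λ x∈ y∈ → inj (to (hL _) x∈) (to (hL _) y∈)) uL ,
    (λ b → mk⇔ (λ b∈ → let (a , a∈ , b≡) = ∈-map⁻ φ b∈ in a , to (hL a) a∈ , sym b≡)
               (λ { (a , Pa , refl) → ∈-map⁺ φ (from (hL a) Pa) })) ,
    trans (cong sum (sym (map-∘ L))) eL

  module _ {P : A → Set} {Q : A → B → Set} {g : A → ℕ} {f : A → B → ℕ} where

    private
      Fibres : List A → Set
      Fibres L = SumOver {A × B} (λ p → proj₁ p ∈ L × Q (proj₁ p) (proj₂ p)) (uncurry f) (sum (map g L))

      fibres : (L : List A) → Unique L → (∀ {a} → a ∈ L → SumOver (Q a) (f a) (g a)) → Fibres L
      fibres [] _ _ = [] , [] , (λ _ → mk⇔ (λ ()) (λ ())) , refl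
      fibres (a ∷ L) (a∉L ∷ uL) H with H (here refl) | fibres L uL (H ∘ there)
      ... | (M , uM , hM , eM) | (F , uF , hF , eF) =
        map (a ,_) M ++ F ,
        Unique.++⁺ (Unique.map⁺ (cong proj₂) uM) uF
          (λ (p∈ , p∈F) → let (_ , _ , p≡) = ∈-map⁻ (a ,_) p∈ in
                          All.lookup a∉L (proj₁ (to (hF _) p∈F)) (sym (cong proj₁ p≡))) ,
        (λ (a′ , b′) → mk⇔ ([ (λ p∈ → let (b , b∈ , p≡) = ∈-map⁻ (a ,_) p∈ in
                               subst (λ p → proj₁ p ∈ a ∷ L × Q (proj₁ p) (proj₂ p)) (sym p≡) (here refl , to (hM b) b∈))
                    , (λ p∈F → let (a∈ , q) = to (hF _) p∈F in there a∈ , q) ]′ ∘ ∈-++⁻ _)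
                   (λ { (here refl , q) → ∈-++⁺ˡ (∈-map⁺ (a ,_) (from (hM _) q))
                      ; (there a∈ , q) → ∈-++⁺ʳ _ (from (hF _) (a∈ , q)) })) ,
        trans (cong sum (map-++ _ (map (a ,_) M) F))
          (trans (sum-++ (map _ (map (a ,_) M)) (map _ F))
            (cong₂ _+_ (trans (cong sum (sym (map-∘ M))) eM) eF))

    sumOver-Σ : ∀ {s} → SumOver P g s → (∀ {a} → P a → SumOver (Q a) (f a) (g a)) →
                SumOver (λ p → P (proj₁ p) × Q (proj₁ p) (proj₂ p)) (uncurry f) s
    sumOver-Σ (L , uL , hL , eL) H with fibres L uL (H ∘ to (hL _))
    ... | (F , uF , hF , eF) =
      F , uF , (λ p → mk⇔ (λ p∈ → let (a∈ , q) = to (hF p) p∈ in to (hL _) a∈ , q)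
                          (λ (Pa , q) → from (hF p) (from (hL _) Pa , q))) ,
      trans eF eL

  module _ {P : A → Set} (P? : Decidable P) where

    length-filter-+-¬ : ∀ xs → length (filter P? xs) + length (filter (¬? ∘ P?) xs) ≡ length xs
    length-filter-+-¬ []       = refl
    length-filter-+-¬ (x ∷ xs) with P? x
    ... | yes _ = cong suc (length-filter-+-¬ xs)
    ... | no  _ = trans (+-suc _ _) (cong suc (length-filter-+-¬ xs))

    private
      count-filter : ∀ {Q : A → Set} {R : A → Set} (R? : Decidable R) L → Unique L → (∀ x → (x ∈ L) ⇔ Q x) →
                     HasCount (λ x → Q x × R x) (length (filter R? L))
      count-filter R? L uL hL = filter R? L , Unique.filter⁺ R? uL ,
        (λ x → mk⇔ (λ x∈ → let (x∈L , Rx) = ∈-filter⁻ R? x∈ in to (hL x) x∈L , Rx)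
                   (λ (Qx , Rx) → ∈-filter⁺ R? (from (hL x) Qx) Rx)) ,
        sum-map-const-1 (filter R? L)

    count-complement : ∀ {Q : A → Set} {n k} → HasCount Q n → HasCount (λ x → Q x × P x) k →
                       HasCount (λ x → Q x × ¬ P x) (n ∸ k)
    count-complement {n = n} {k} (L , uL , hL , count≡) count-P =
      subst (HasCount _) length≡ (count-filter (¬? ∘ P?) L uL hL)
      where
      k≡ : length (filter P? L) ≡ k
      k≡ = sumOver-unique (count-filter P? L uL hL) count-P
      length≡ : length (filter (¬? ∘ P?) L) ≡ n ∸ k
      length≡ = trans (sym (m+n∸m≡n (length (filter P? L)) _))
                  (cong₂ _∸_ (trans (length-filter-+-¬ L) (trans (sym (sum-map-const-1 L)) count≡)) k≡)


module Rotations where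

  open import Data.Nat using (ℕ; zero; suc; _+_; _*_; _∸_; _≤_; _<_; z≤n; s≤s; _≟_; _%_; _/_)
  open import Data.Nat.Properties
  open import Data.Nat.DivMod using (m≡m%n+[m/n]*n; m%n<n)
  open import Data.List using (List; []; _∷_; _++_; [_]; length; take; drop; concat; replicate)
  open import Data.List.Properties
    using (∷-injective; ++-assoc; ++-identityʳ; length-++; ++-cancelˡ; ∷ʳ-injective; take++drop≡id;
           length-take; length-drop; ≡-dec; ++-conicalˡ)
  open import Data.List.Relation.Binary.Permutation.Propositional using (_↭_; ↭-refl; ↭-sym; ↭-trans)
  open import Data.List.Relation.Binary.Permutation.Propositional.Properties using (∷↭∷ʳ)
  open import Data.Product using (Σ; _×_; _,_)
  open import Data.Sum using (_⊎_; inj₁; inj₂)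
  open import Data.Empty using (⊥-elim)
  open import Relation.Nullary using (¬_; yes; no)
  open import Relation.Binary.Definitions using (DecidableEquality; tri<; tri≈; tri>)
  open import Relation.Binary.PropositionalEquality hiding ([_])

  module _ {A : Set} where

    rot₁ : List A → List A
    rot₁ []       = []
    rot₁ (x ∷ xs) = xs ++ [ x ]

    -- Unlike `rotate`, `rot` keeps turning past the length of the list.
    rot : ℕ → List A → List A
    rot zero    a = a
    rot (suc i) a = rot i (rot₁ a)

    rot-+ : ∀ i j a → rot (i + j) a ≡ rot j (rot i a)
    rot-+ zero    j a = refl
    rot-+ (suc i) j a = rot-+ i j (rot₁ a)

    rot-↭ : ∀ i a → rot i a ↭ a
    rot-↭ zero    a        = ↭-refl
    rot-↭ (suc i) []       = rot-↭ i []
    rot-↭ (suc i) (x ∷ xs) = ↭-trans (rot-↭ i (xs ++ [ x ])) (↭-sym (∷↭∷ʳ x xs))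

    rot-comm : ∀ i j a → rot i (rot j a) ≡ rot j (rot i a)
    rot-comm i j a = trans (sym (rot-+ j i a)) (trans (cong (λ k → rot k a) (+-comm j i)) (rot-+ i j a))

    rot-[] : ∀ i → rot i [] ≡ []
    rot-[] zero    = refl
    rot-[] (suc i) = rot-[] i

    length-rot : ∀ i a → length (rot i a) ≡ length a
    length-rot zero    a        = refl
    length-rot (suc i) []       = length-rot i []
    length-rot (suc i) (x ∷ xs) = trans (length-rot i (xs ++ [ x ])) (trans (length-++ xs) (+-comm (length xs) 1))

    rot-++ : ∀ xs ys → rot (length xs) (xs ++ ys) ≡ ys ++ xs
    rot-++ []       ys = sym (++-identityʳ ys)
    rot-++ (x ∷ xs) ys =
      trans (cong (rot (length xs)) (++-assoc xs ys [ x ]))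
            (trans (rot-++ xs (ys ++ [ x ])) (++-assoc ys [ x ] xs))

    rot-length : ∀ a → rot (length a) a ≡ a
    rot-length a = subst (λ b → rot (length a) b ≡ a) (++-identityʳ a) (rot-++ a [])

    rot-*-length : ∀ q a → rot (q * length a) a ≡ a
    rot-*-length zero    a = refl
    rot-*-length (suc q) a =
      trans (rot-+ (length a) (q * length a) a) (trans (cong (rot (q * length a)) (rot-length a)) (rot-*-length q a))

    rot-mod-length : ∀ t a → 0 < length a → Σ ℕ λ t′ → t′ < length a × rot t a ≡ rot t′ a
    rot-mod-length t a 0<len with length a in len≡
    ... | suc k = t % suc k , m%n<n t (suc k) ,
      (begin
        rot t a                                   ≡⟨ cong (λ i → rot i a) (trans (m≡m%n+[m/n]*n t (suc k)) (+-comm (t % suc k) _)) ⟩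
        rot (t / suc k * suc k + t % suc k) a     ≡⟨ cong (λ l → rot (t / suc k * l + t % suc k) a) (sym len≡) ⟩
        rot (t / suc k * length a + t % suc k) a  ≡⟨ rot-+ (t / suc k * length a) (t % suc k) a ⟩
        rot (t % suc k) (rot (t / suc k * length a) a) ≡⟨ cong (rot (t % suc k)) (rot-*-length (t / suc k) a) ⟩
        rot (t % suc k) a                         ∎)
      where open ≡-Reasoning

    rot∸-inverse : ∀ j a → j ≤ length a → rot (length a ∸ j) (rot j a) ≡ a
    rot∸-inverse j a j≤ =
      trans (sym (rot-+ j (length a ∸ j) a)) (trans (cong (λ i → rot i a) (m+[n∸m]≡n j≤)) (rot-length a))

    length-take-≤ : ∀ j (a : List A) → j ≤ length a → length (take j a) ≡ j
    length-take-≤ j a j≤ = trans (length-take j a) (m≤n⇒m⊓n≡m j≤)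

    rot≡drop++take : ∀ j a → j ≤ length a → rot j a ≡ drop j a ++ take j a
    rot≡drop++take j a j≤ =
      trans (cong₂ rot (sym (length-take-≤ j a j≤)) (sym (take++drop≡id j a))) (rot-++ (take j a) (drop j a))

    rot₁-injective : ∀ a b → rot₁ a ≡ rot₁ b → a ≡ b
    rot₁-injective []       []       _ = refl
    rot₁-injective []       (y ∷ ys) e = ⊥-elim (snoc≢[] ys (sym e))
      where snoc≢[] : ∀ ys {y} → ys ++ [ y ] ≢ []
            snoc≢[] [] () ; snoc≢[] (_ ∷ _) ()
    rot₁-injective (x ∷ xs) []       e = ⊥-elim (snoc≢[] xs e)
      where snoc≢[] : ∀ ys {y} → ys ++ [ y ] ≢ []
            snoc≢[] [] () ; snoc≢[] (_ ∷ _) ()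
    rot₁-injective (x ∷ xs) (y ∷ ys) e with ∷ʳ-injective xs ys e
    ... | refl , refl = refl

    rot-injective : ∀ i a b → rot i a ≡ rot i b → a ≡ b
    rot-injective zero    a b e = e
    rot-injective (suc i) a b e = rot₁-injective a b (rot-injective i (rot₁ a) (rot₁ b) e)

    power : ℕ → List A → List A
    power q x = concat (replicate q x)

    power-[] : ∀ q → power q [] ≡ []
    power-[] zero    = refl
    power-[] (suc q) = power-[] q

    power-+ : ∀ r s z → power (r + s) z ≡ power r z ++ power s z
    power-+ zero    s z = refl
    power-+ (suc r) s z = trans (cong (z ++_) (power-+ r s z)) (sym (++-assoc z (power r z) (power s z)))

    power-* : ∀ k q p → power (k * q) p ≡ power k (power q p)
    power-* zero    q p = refl
    power-* (suc k) q p = trans (power-+ q (k * q) p) (cong (power q p ++_) (power-* k q p))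

    length-power : ∀ q z → length (power q z) ≡ q * length z
    length-power zero    z = refl
    length-power (suc q) z = trans (length-++ z) (cong (length z +_) (length-power q z))

    power-++-comm : ∀ q u v → power q (u ++ v) ++ u ≡ u ++ power q (v ++ u)
    power-++-comm zero    u v = sym (++-identityʳ u)
    power-++-comm (suc q) u v = begin
      ((u ++ v) ++ power q (u ++ v)) ++ u  ≡⟨ ++-assoc (u ++ v) (power q (u ++ v)) u ⟩
      (u ++ v) ++ power q (u ++ v) ++ u    ≡⟨ ++-assoc u v _ ⟩
      u ++ v ++ power q (u ++ v) ++ u      ≡⟨ cong (λ z → u ++ v ++ z) (power-++-comm q u v) ⟩
      u ++ v ++ u ++ power q (v ++ u)      ≡⟨ cong (u ++_) (sym (++-assoc v u _)) ⟩
      u ++ (v ++ u) ++ power q (v ++ u)    ∎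
      where open ≡-Reasoning

    rot-power-++ : ∀ q u v → rot (length u) (power q (u ++ v)) ≡ power q (v ++ u)
    rot-power-++ zero    u v = rot-[] (length u)
    rot-power-++ (suc q) u v = begin
      rot (length u) ((u ++ v) ++ power q (u ++ v))  ≡⟨ cong (rot (length u)) (++-assoc u v _) ⟩
      rot (length u) (u ++ v ++ power q (u ++ v))    ≡⟨ rot-++ u (v ++ power q (u ++ v)) ⟩
      (v ++ power q (u ++ v)) ++ u                    ≡⟨ ++-assoc v _ u ⟩
      v ++ power q (u ++ v) ++ u                      ≡⟨ cong (v ++_) (power-++-comm q u v) ⟩
      v ++ u ++ power q (v ++ u)                      ≡⟨ sym (++-assoc v u _) ⟩
      (v ++ u) ++ power q (v ++ u)                    ∎
      where open ≡-Reasoning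

    rot-power : ∀ q i x → i ≤ length x → rot i (power q x) ≡ power q (rot i x)
    rot-power q i x i≤ =
      trans (cong₂ rot (sym (length-take-≤ i x i≤)) (cong (power q) (sym (take++drop≡id i x))))
        (trans (rot-power-++ q (take i x) (drop i x)) (cong (power q) (sym (rot≡drop++take i x i≤))))

    power-comm : ∀ q b → power q b ++ b ≡ b ++ power q b
    power-comm zero    b = sym (++-identityʳ b)
    power-comm (suc q) b = trans (++-assoc b (power q b) b) (cong (b ++_) (power-comm q b))

    ++-prefix : ∀ (u v x y : List A) → u ++ v ≡ x ++ y → length u ≤ length x → Σ (List A) λ w → x ≡ u ++ w
    ++-prefix []      v x       y e le       = x , refl
    ++-prefix (a ∷ u) v (b ∷ x) y e (s≤s le) with ∷-injective e
    ... | refl , e′ with ++-prefix u v x y e′ le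
    ... | w , refl = w , refl

    ++-prefix-≡ : ∀ (xs ys zs ws : List A) → xs ++ ys ≡ zs ++ ws → length xs ≡ length zs → xs ≡ zs
    ++-prefix-≡ []       ys []       ws e l = refl
    ++-prefix-≡ (x ∷ xs) ys (z ∷ zs) ws e l with ∷-injective e
    ... | refl , e′ = cong (x ∷_) (++-prefix-≡ xs ys zs ws e′ (suc-injective l))

    CommonRoot : List A → List A → Set
    CommonRoot u v = Σ (List A) λ z → Σ ℕ λ r → Σ ℕ λ s → u ≡ power r z × v ≡ power s z

    ++-comm⇒CommonRoot : ∀ (u v : List A) → u ++ v ≡ v ++ u → CommonRoot u v
    ++-comm⇒CommonRoot u v = go (suc (length u + length v)) u v ≤-refl
      where
      swap : ∀ {u v} → CommonRoot u v → CommonRoot v u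
      swap (z , r , s , u≡ , v≡) = z , s , r , v≡ , u≡

      go : ∀ N (u v : List A) → length u + length v < N → u ++ v ≡ v ++ u → CommonRoot u v
      shorter-first : ∀ N (u v : List A) → 0 < length u → length u + length v ≤ N → u ++ v ≡ v ++ u →
                      length u ≤ length v → CommonRoot u v

      go zero    _       _       () _
      go (suc N) []      v       _  _ = v , 0 , 1 , refl , sym (++-identityʳ v)
      go (suc N) (a ∷ u) []      _  _ = a ∷ u , 1 , 0 , sym (++-identityʳ _) , refl
      go (suc N) (a ∷ u) (b ∷ v) lt uv≡vu with ≤-total (length (a ∷ u)) (length (b ∷ v))
      ... | inj₁ u≤v = shorter-first N (a ∷ u) (b ∷ v) (s≤s z≤n) (≤-pred lt) uv≡vu u≤v
      ... | inj₂ v≤u = swap (shorter-first N (b ∷ v) (a ∷ u) (s≤s z≤n)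
                         (≤-pred (subst (_< suc N) (+-comm (length (a ∷ u)) _) lt)) (sym uv≡vu) v≤u)

      shorter-first N u v 0<u le uv≡vu u≤v with ++-prefix u v v u uv≡vu u≤v
      ... | w , refl with go N u w shorter (++-cancelˡ u _ _ (trans uv≡vu (++-assoc u w u)))
        where
        shorter : length u + length w < N
        shorter = <-≤-trans (+-monoʳ-< (length u) (m<n+m (length w) 0<u))
                            (≤-trans (≤-reflexive (cong (length u +_) (sym (length-++ u)))) le)
      ... | z , r , s , refl , refl = z , r , r + s , refl , sym (power-+ r s z)

    Primitive : List A → Set
    Primitive a = ∀ i → 0 < i → i < length a → rot i a ≢ a

    Aperiodic : List A → Set
    Aperiodic a = ¬ (Σ (List A) λ b → Σ ℕ λ k → length b < length a × 2 ≤ k × a ≡ power k b)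

    primitive⇒aperiodic : ∀ a → Primitive a → Aperiodic a
    primitive⇒aperiodic a prim ([] , k , lt , _ , a≡) with trans a≡ (power-[] k)
    ... | refl with lt
    ... | ()
    primitive⇒aperiodic a prim (c ∷ b , suc k , lt , _ , a≡) =
      prim (length (c ∷ b)) (s≤s z≤n) lt
        (trans (cong (rot (length (c ∷ b))) a≡)
          (trans (rot-++ (c ∷ b) (power k (c ∷ b))) (trans (power-comm k (c ∷ b)) (sym a≡))))

    rot-fixed⇒proper-power : ∀ a i → 0 < i → i < length a → rot i a ≡ a →
      Σ (List A) λ z → Σ ℕ λ k → 2 ≤ k × length z < length a × z ≢ [] × a ≡ power k z
    rot-fixed⇒proper-power a i 0<i i<n rot≡ with ++-comm⇒CommonRoot (take i a) (drop i a)
      (sym (trans (sym (rot≡drop++take i a (<⇒≤ i<n))) (trans rot≡ (sym (take++drop≡id i a)))))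
    ... | z , r , s , take≡ , drop≡ = proper z r s take≡ drop≡
      where
      length-take-i : length (take i a) ≡ i
      length-take-i = length-take-≤ i a (<⇒≤ i<n)

      proper : ∀ z r s → take i a ≡ power r z → drop i a ≡ power s z →
               Σ (List A) λ z → Σ ℕ λ k → 2 ≤ k × length z < length a × z ≢ [] × a ≡ power k z
      proper z zero s take≡ _ = ⊥-elim (<-irrefl (trans (sym (cong length take≡)) length-take-i) 0<i)
      proper [] (suc r) s take≡ _ =
        ⊥-elim (<-irrefl (trans (sym (cong length (trans take≡ (power-[] (suc r))))) length-take-i) 0<i)
      proper (c ∷ z) (suc r) zero _ drop≡ =
        ⊥-elim (<⇒≱ i<n (m∸n≡0⇒m≤n (trans (sym (length-drop i a)) (cong length drop≡))))
      proper (c ∷ z) (suc r) (suc s) take≡ drop≡ = c ∷ z , suc r + suc s , 2≤k , z-shorter , (λ ()) , a≡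
        where
        a≡ : a ≡ power (suc r + suc s) (c ∷ z)
        a≡ = trans (sym (take++drop≡id i a)) (trans (cong₂ _++_ take≡ drop≡) (sym (power-+ (suc r) (suc s) (c ∷ z))))
        2≤k : 2 ≤ suc r + suc s
        2≤k = s≤s (≤-trans (s≤s z≤n) (m≤n+m (suc s) r))
        z-shorter : length (c ∷ z) < length a
        z-shorter = subst (length (c ∷ z) <_) (sym (trans (cong length a≡) (length-power (suc r + suc s) (c ∷ z))))
                      (m<m+n (length (c ∷ z)) (subst (0 <_) (cong (_* length (c ∷ z)) (sym (+-suc r s))) (s≤s z≤n)))

    aperiodic⇒primitive : ∀ a → Aperiodic a → Primitive a
    aperiodic⇒primitive a aper i 0<i i<n rot≡ with rot-fixed⇒proper-power a i 0<i i<n rot≡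
    ... | z , k , 2≤k , shorter , _ , a≡ = aper (z , k , shorter , 2≤k , a≡)

    primitive-rot : ∀ a → Primitive a → ∀ j → Primitive (rot j a)
    primitive-rot a prim j i 0<i i<n rot≡ =
      prim i 0<i (subst (i <_) (length-rot j a) i<n) (rot-injective j (rot i a) a (trans (rot-comm j i a) rot≡))

    primitive-rot-distinct : ∀ x → Primitive x → ∀ j j′ → j < j′ → j′ < length x → rot j x ≢ rot j′ x
    primitive-rot-distinct x prim j j′ j<j′ j′< rot≡ =
      primitive-rot x prim j (j′ ∸ j) (m<n⇒0<n∸m j<j′)
        (subst ((j′ ∸ j) <_) (sym (length-rot j x)) (≤-<-trans (m∸n≤m j′ j) j′<))
        (trans (sym (rot-+ j (j′ ∸ j) x)) (trans (cong (λ i → rot i x) (m+[n∸m]≡n (<⇒≤ j<j′))) (sym rot≡)))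

    primitive-rot-injective : ∀ x → Primitive x → ∀ j j′ → j < length x → j′ < length x → rot j x ≡ rot j′ x → j ≡ j′
    primitive-rot-injective x prim j j′ j< j′< rot≡ with <-cmp j j′
    ... | tri≈ _ j≡j′ _ = j≡j′
    ... | tri< j<j′ _ _ = ⊥-elim (primitive-rot-distinct x prim j j′ j<j′ j′< rot≡)
    ... | tri> _ _ j′<j = ⊥-elim (primitive-rot-distinct x prim j′ j j′<j j< (sym rot≡))

    power-primitive-shortest : ∀ (x y : List A) q q′ → Primitive y → 1 ≤ q′ → power q x ≡ power q′ y →
                               ¬ length x < length y
    power-primitive-shortest [] y q (suc q′) _ _ pow≡ lt
      with ++-conicalˡ y (power q′ y) (trans (sym pow≡) (power-[] q))
    ... | refl with lt
    ... | ()
    power-primitive-shortest (c ∷ x) y q (suc q′) prim-y _ pow≡ lt =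
      prim-y ℓ (s≤s z≤n) lt (++-prefix-≡ _ (power q′ (rot ℓ y)) y (power q′ y) rot-y^q′ (length-rot ℓ y))
      where
      ℓ = length (c ∷ x)
      rot-y^q′ : rot ℓ y ++ power q′ (rot ℓ y) ≡ y ++ power q′ y
      rot-y^q′ = begin
        power (suc q′) (rot ℓ y)  ≡⟨ sym (rot-power (suc q′) ℓ y (<⇒≤ lt)) ⟩
        rot ℓ (power (suc q′) y)  ≡⟨ cong (rot ℓ) (sym pow≡) ⟩
        rot ℓ (power q (c ∷ x))   ≡⟨ rot-power q ℓ (c ∷ x) ≤-refl ⟩
        power q (rot ℓ (c ∷ x))   ≡⟨ cong (power q) (rot-length (c ∷ x)) ⟩
        power q (c ∷ x)           ≡⟨ pow≡ ⟩
        power (suc q′) y          ∎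
        where open ≡-Reasoning

    power-primitive-injective : ∀ (x y : List A) q q′ → Primitive x → Primitive y → 1 ≤ q → 1 ≤ q′ →
                                power q x ≡ power q′ y → x ≡ y
    power-primitive-injective x y q q′ prim-x prim-y 1≤q 1≤q′ pow≡ with <-cmp (length x) (length y)
    ... | tri< lt _ _ = ⊥-elim (power-primitive-shortest x y q q′ prim-y 1≤q′ pow≡ lt)
    ... | tri> _ _ gt = ⊥-elim (power-primitive-shortest y x q′ q prim-x 1≤q (sym pow≡) gt)
    ... | tri≈ _ len≡ _ with q | q′
    ...   | suc r | suc r′ = ++-prefix-≡ x (power r x) y (power r′ y) pow≡ len≡

  module _ {A : Set} (_≟_ : DecidableEquality A) where

    rot-fixed? : (a : List A) (B : ℕ) → (Σ ℕ λ i → 0 < i × i < B × rot i a ≡ a) ⊎ (∀ i → 0 < i → i < B → rot i a ≢ a)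
    rot-fixed? a zero = inj₂ (λ i _ ())
    rot-fixed? a (suc B) with rot-fixed? a B
    ... | inj₁ (i , 0<i , i<B , rot≡) = inj₁ (i , 0<i , m<n⇒m<1+n i<B , rot≡)
    ... | inj₂ none with B | ≡-dec _≟_ (rot B a) a
    ...   | zero   | _         = inj₂ (λ { i 0<i (s≤s i≤0) _ → <-irrefl refl (<-≤-trans 0<i i≤0) })
    ...   | suc B′ | yes rot≡  = inj₁ (suc B′ , s≤s z≤n , ≤-refl , rot≡)
    ...   | suc B′ | no  rot≢  = inj₂ λ i 0<i i<B → extend i 0<i (≤-pred i<B)
      where
      extend : ∀ i → 0 < i → i ≤ suc B′ → rot i a ≢ a
      extend i 0<i i≤ with m≤n⇒m<n∨m≡n i≤
      ... | inj₁ i<B = none i 0<i i<B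
      ... | inj₂ refl = rot≢

    primitive-root : ∀ (a : List A) → a ≢ [] → Σ (List A) λ p → Σ ℕ λ q → Primitive p × 1 ≤ q × a ≡ power q p
    primitive-root a = go (length a) a ≤-refl
      where
      go : ∀ N (a : List A) → length a ≤ N → a ≢ [] → Σ (List A) λ p → Σ ℕ λ q → Primitive p × 1 ≤ q × a ≡ power q p
      go zero    []      _  a≢[] = ⊥-elim (a≢[] refl)
      go (suc N) a       le a≢[] with rot-fixed? a (length a)
      ... | inj₂ prim = a , 1 , prim , s≤s z≤n , sym (++-identityʳ a)
      ... | inj₁ (i , 0<i , i<n , rot≡) with rot-fixed⇒proper-power a i 0<i i<n rot≡
      ...   | z , k , 2≤k , shorter , z≢[] , a≡ with go N z (≤-pred (<-≤-trans shorter le)) z≢[]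
      ...     | p , q , prim , 1≤q , z≡ =
        p , k * q , prim , *-mono-≤ (≤-trans (s≤s z≤n) 2≤k) 1≤q ,
        trans a≡ (trans (cong (power k) z≡) (sym (power-* k q p)))


module LyndonWords where

  open import Data.Nat using (ℕ; zero; suc; _+_; _*_; _∸_; _^_; _≤_; _<_; z≤n; s≤s; _≟_; _/_)
  open import Data.Nat.Properties
  open import Data.Nat.DivMod using (m*n/n≡m)
  open import Data.Nat.Divisibility using (_∣_; divides)
  open import Data.List using (List; []; _∷_; _++_; [_]; length; take; drop; map; upTo; applyUpTo)
  open import Data.List.Properties using (map-++; length-drop; map-applyUpTo)
  open import Data.List.Relation.Unary.All using (All; []; _∷_)
  import Data.List.Relation.Unary.All.Properties as All
  open import Data.List.Relation.Binary.Lex.Strict using (<-compare; <-transitive; <-asymmetric)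
  open import Data.List.Relation.Binary.Pointwise using (Pointwise-≡⇒≡)
  import Data.List.Relation.Unary.Unique.Propositional.Properties as Unique
  open import Data.Nat.ListAction using (sum; product)
  open import Data.Nat.ListAction.Properties using (sum-++; product-++; sum-↭; product-↭)
  open import Data.List.Relation.Binary.Permutation.Propositional using (↭-sym)
  import Data.List.Relation.Binary.Permutation.Propositional.Properties as ↭
  open import Data.List.Relation.Binary.Permutation.Propositional.Properties using (All-resp-↭)
  open import Function using (_∘_)
  open import Data.Product using (Σ; _×_; _,_; proj₁; proj₂)
  open import Data.Sum using (_⊎_; inj₁; inj₂)
  open import Data.Empty using (⊥-elim)
  open import Relation.Nullary using (¬_)
  open import Relation.Binary.Definitions using (tri<; tri≈; tri>)
  open import Relation.Binary.PropositionalEquality hiding ([_])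
  open import Defs using (SumOver; IsLyndonComposition; CP; _<lex_)
  open FiniteSums
  open Rotations

  <lex-trans : ∀ {x y z} → x <lex y → y <lex z → x <lex z
  <lex-trans = <-transitive isEquivalence (resp₂ _<_) <-trans

  <lex-asym : ∀ {x y} → x <lex y → ¬ y <lex x
  <lex-asym = <-asymmetric sym (resp₂ _<_) <-asym

  <-suc-extend : ∀ {P : ℕ → Set} N → (∀ i → i < N → P i) → P N → ∀ i → i < suc N → P i
  <-suc-extend N below at-N i i< with m≤n⇒m<n∨m≡n (≤-pred i<)
  ... | inj₁ i<N  = below i i<N
  ... | inj₂ refl = at-N

  least-rotation : (p : List ℕ) → ∀ N → 1 ≤ N →
                   Σ ℕ λ j → j < N × (∀ i → i < N → rot j p ≡ rot i p ⊎ rot j p <lex rot i p)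
  least-rotation p (suc zero)    _ = 0 , s≤s z≤n , λ { zero _ → inj₁ refl ; (suc i) (s≤s ()) }
  least-rotation p (suc (suc N)) _ with least-rotation p (suc N) (s≤s z≤n)
  ... | j , j< , least with <-compare sym <-cmp (rot j p) (rot (suc N) p)
  ...   | tri< j<N _ _ = j , m<n⇒m<1+n j< , <-suc-extend (suc N) least (inj₂ j<N)
  ...   | tri≈ _ j≈N _ = j , m<n⇒m<1+n j< , <-suc-extend (suc N) least (inj₁ (Pointwise-≡⇒≡ j≈N))
  ...   | tri> _ _ N<j = suc N , ≤-refl , <-suc-extend (suc N) (λ i i<N → inj₂ (N<i i i<N)) (inj₁ refl)
    where
    N<i : ∀ i → i < suc N → rot (suc N) p <lex rot i p
    N<i i i<N with least i i<N
    ... | inj₁ j≡i = subst (rot (suc N) p <lex_) j≡i N<j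
    ... | inj₂ j<i = <lex-trans N<j j<i

  module _ {d : ℕ} {ℓ : List ℕ} (lyndon : IsLyndonComposition d ℓ) where

    lyndon⇒primitive : Primitive ℓ
    lyndon⇒primitive = aperiodic⇒primitive ℓ (proj₁ (proj₂ (proj₂ lyndon)))

    lyndon-least : ∀ i → 0 < i → i < length ℓ → ℓ <lex rot i ℓ
    lyndon-least i 0<i i< = subst (ℓ <lex_) (sym (rot≡drop++take i ℓ (<⇒≤ i<))) (proj₂ (proj₂ (proj₂ lyndon)) i 0<i i<)

  lyndon-rot-unique : ∀ {d d′ ℓ ℓ′} → IsLyndonComposition d ℓ → IsLyndonComposition d′ ℓ′ →
                      ∀ t → ℓ′ ≡ rot t ℓ → ℓ′ ≡ ℓ
  lyndon-rot-unique {ℓ = []}    {ℓ′} _ _ t ℓ′≡ = trans ℓ′≡ (rot-[] t)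
  lyndon-rot-unique {ℓ = x ∷ ℓ} {ℓ′} L L′ t ℓ′≡ with rot-mod-length t (x ∷ ℓ) (s≤s z≤n)
  ... | zero   , _  , rot≡ = trans ℓ′≡ rot≡
  ... | suc t′ , t< , rot≡ = ⊥-elim (<lex-asym ℓ<ℓ′ ℓ′<ℓ)
    where
    ℓ′≡rot : ℓ′ ≡ rot (suc t′) (x ∷ ℓ)
    ℓ′≡rot = trans ℓ′≡ rot≡
    length-ℓ′ : length ℓ′ ≡ length (x ∷ ℓ)
    length-ℓ′ = trans (cong length ℓ′≡rot) (length-rot (suc t′) (x ∷ ℓ))
    ℓ<ℓ′ : (x ∷ ℓ) <lex ℓ′
    ℓ<ℓ′ = subst ((x ∷ ℓ) <lex_) (sym ℓ′≡rot) (lyndon-least L (suc t′) (s≤s z≤n) t<)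
    ℓ′<ℓ : ℓ′ <lex (x ∷ ℓ)
    ℓ′<ℓ = subst (ℓ′ <lex_) (trans (cong (rot (length (x ∷ ℓ) ∸ suc t′)) ℓ′≡rot) (rot∸-inverse (suc t′) (x ∷ ℓ) (<⇒≤ t<)))
             (lyndon-least L′ (length (x ∷ ℓ) ∸ suc t′) (m<n⇒0<n∸m t<)
               (subst (length (x ∷ ℓ) ∸ suc t′ <_) (sym length-ℓ′) (∸-monoʳ-< {length (x ∷ ℓ)} (s≤s z≤n) (<⇒≤ t<))))

  IsCompositionℕ : ℕ → List ℕ → Set
  IsCompositionℕ m a = All (λ x → 1 ≤ x) a × sum a ≡ m

  weight : List ℕ → ℕ
  weight a = product (map CP (map (λ x → x ∸ 1) a))

  head₀ : List ℕ → ℕ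
  head₀ []      = 0
  head₀ (x ∷ _) = x

  head₀-++ : ∀ x y → 0 < length x → head₀ (x ++ y) ≡ head₀ x
  head₀-++ (c ∷ x) y _ = refl

  sum-rot : ∀ j a → sum (rot j a) ≡ sum a
  sum-rot j a = sum-↭ (rot-↭ j a)

  sum-power : ∀ q a → sum (power q a) ≡ q * sum a
  sum-power zero    a = refl
  sum-power (suc q) a = trans (sum-++ a (power q a)) (cong (sum a +_) (sum-power q a))

  weight-rot : ∀ j a → weight (rot j a) ≡ weight a
  weight-rot j a = product-↭ (↭.map⁺ CP (↭.map⁺ (λ x → x ∸ 1) (rot-↭ j a)))

  weight-++ : ∀ xs ys → weight (xs ++ ys) ≡ weight xs * weight ys
  weight-++ xs ys = begin
    product (map CP (map (λ x → x ∸ 1) (xs ++ ys)))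
      ≡⟨ cong (product ∘ map CP) (map-++ (λ x → x ∸ 1) xs ys) ⟩
    product (map CP (map (λ x → x ∸ 1) xs ++ map (λ x → x ∸ 1) ys))
      ≡⟨ cong product (map-++ CP (map (λ x → x ∸ 1) xs) _) ⟩
    product (map CP (map (λ x → x ∸ 1) xs) ++ map CP (map (λ x → x ∸ 1) ys))
      ≡⟨ product-++ (map CP (map (λ x → x ∸ 1) xs)) _ ⟩
    weight xs * weight ys ∎
    where open ≡-Reasoning

  weight-power : ∀ q a → weight (power q a) ≡ weight a ^ q
  weight-power zero    a = refl
  weight-power (suc q) a = trans (weight-++ a (power q a)) (cong (weight a *_) (weight-power q a))

  module _ {P : ℕ → Set} where

    All-rot : ∀ j a → All P a → All P (rot j a)
    All-rot j a = All-resp-↭ (↭-sym (rot-↭ j a))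

    All-power⁺ : ∀ q a → All P a → All P (power q a)
    All-power⁺ zero    a _  = []
    All-power⁺ (suc q) a pa = All.++⁺ pa (All-power⁺ q a pa)

    All-power⁻ : ∀ q a → 1 ≤ q → All P (power q a) → All P a
    All-power⁻ (suc q) a _ = All.++⁻ˡ a

  -- `quotient m 0 = 0` is a junk value: below the divisor is always positive.
  quotient : ℕ → ℕ → ℕ
  quotient m zero    = 0
  quotient m (suc d) = m / suc d

  quotient-exact : ∀ {m} d q → d * q ≡ m → 1 ≤ d → quotient m d ≡ q
  quotient-exact (suc d) q refl _ = trans (cong (_/ suc d) (*-comm (suc d) q)) (m*n/n≡m q (suc d))

  divisor-positive : ∀ {m} d q → 1 ≤ m → d * q ≡ m → 1 ≤ d
  divisor-positive zero    q () refl
  divisor-positive (suc d) q _  _ = s≤s z≤n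

  cofactor-positive : ∀ {m} d q → 1 ≤ m → d * q ≡ m → 1 ≤ q
  cofactor-positive d q 1≤m dq≡m = divisor-positive q d 1≤m (trans (*-comm q d) dq≡m)

  LyndonRotation : ℕ → ℕ × List ℕ × ℕ → Set
  LyndonRotation m (d , ℓ , j) = IsLyndonComposition d ℓ × j < length ℓ × Σ ℕ (λ q → d * q ≡ m)

  unroll : ℕ → ℕ × List ℕ × ℕ → List ℕ
  unroll m (d , ℓ , j) = rot j (power (quotient m d) ℓ)

  unroll≡ : ∀ {m d q} ℓ j → 1 ≤ d → d * q ≡ m → j ≤ length ℓ → unroll m (d , ℓ , j) ≡ power q (rot j ℓ)
  unroll≡ {d = d} {q} ℓ j 1≤d dq≡m j≤ =
    trans (cong (λ k → rot j (power k ℓ)) (quotient-exact d q dq≡m 1≤d)) (rot-power q j ℓ j≤)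

  module _ {m : ℕ} (1≤m : 1 ≤ m) where

    unroll-LyndonRotation : ∀ {d ℓ j q} → IsLyndonComposition d ℓ → j < length ℓ → d * q ≡ m →
                            unroll m (d , ℓ , j) ≡ power q (rot j ℓ)
    unroll-LyndonRotation {d} {ℓ} {j} {q} _ j< dq≡m = unroll≡ ℓ j (divisor-positive d q 1≤m dq≡m) dq≡m (<⇒≤ j<)

    unroll-injective : ∀ {x y} → LyndonRotation m x → LyndonRotation m y → unroll m x ≡ unroll m y → x ≡ y
    unroll-injective {d , ℓ , j} {d′ , ℓ′ , j′} (L , j< , q , dq≡m) (L′ , j′< , q′ , dq≡m′) unroll≡′ =
      cong₂ _,_ d≡d′ (cong₂ _,_ (sym ℓ′≡ℓ) j≡j′)
      where
      rot≡ : rot j ℓ ≡ rot j′ ℓ′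
      rot≡ = power-primitive-injective (rot j ℓ) (rot j′ ℓ′) q q′
               (primitive-rot ℓ (lyndon⇒primitive L) j) (primitive-rot ℓ′ (lyndon⇒primitive L′) j′)
               (cofactor-positive d q 1≤m dq≡m) (cofactor-positive d′ q′ 1≤m dq≡m′)
               (trans (sym (unroll-LyndonRotation L j< dq≡m)) (trans unroll≡′ (unroll-LyndonRotation L′ j′< dq≡m′)))
      ℓ′≡ℓ : ℓ′ ≡ ℓ
      ℓ′≡ℓ = lyndon-rot-unique L L′ (j + (length ℓ′ ∸ j′)) (begin
        ℓ′                                    ≡⟨ sym (rot∸-inverse j′ ℓ′ (<⇒≤ j′<)) ⟩
        rot (length ℓ′ ∸ j′) (rot j′ ℓ′)      ≡⟨ cong (rot (length ℓ′ ∸ j′)) (sym rot≡) ⟩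
        rot (length ℓ′ ∸ j′) (rot j ℓ)        ≡⟨ sym (rot-+ j (length ℓ′ ∸ j′) ℓ) ⟩
        rot (j + (length ℓ′ ∸ j′)) ℓ          ∎)
        where open ≡-Reasoning
      d≡d′ : d ≡ d′
      d≡d′ = trans (sym (proj₁ (proj₂ L))) (trans (cong sum (sym ℓ′≡ℓ)) (proj₁ (proj₂ L′)))
      j≡j′ : j ≡ j′
      j≡j′ = primitive-rot-injective ℓ (lyndon⇒primitive L) j j′ j< (subst (j′ <_) (cong length ℓ′≡ℓ) j′<)
               (trans rot≡ (cong (rot j′) ℓ′≡ℓ))

    unroll-IsCompositionℕ : ∀ {x} → LyndonRotation m x → IsCompositionℕ m (unroll m x)
    unroll-IsCompositionℕ {d , ℓ , j} (L , j< , q , dq≡m) rewrite unroll-LyndonRotation L j< dq≡m =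
      All-power⁺ q (rot j ℓ) (All-rot j ℓ (proj₁ L)) ,
      trans (sum-power q (rot j ℓ)) (trans (cong (q *_) (trans (sum-rot j ℓ) (proj₁ (proj₂ L)))) (trans (*-comm q d) dq≡m))

    head₀-weight-unroll : ∀ {d ℓ j} → LyndonRotation m (d , ℓ , j) →
      head₀ (unroll m (d , ℓ , j)) * weight (unroll m (d , ℓ , j)) ≡ head₀ (rot j ℓ) * weight ℓ ^ quotient m d
    head₀-weight-unroll {d} {ℓ} {j} (L , j< , q , dq≡m)
      rewrite unroll-LyndonRotation L j< dq≡m | quotient-exact d q dq≡m (divisor-positive d q 1≤m dq≡m)
      with q | cofactor-positive d q 1≤m dq≡m
    ... | suc q′ | _ =
      cong₂ _*_ (head₀-++ (rot j ℓ) (power q′ (rot j ℓ)) (subst (0 <_) (sym (length-rot j ℓ)) (≤-<-trans z≤n j<)))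
                (trans (weight-power (suc q′) (rot j ℓ)) (cong (_^ suc q′) (weight-rot j ℓ)))

  least-rotation-lyndon : ∀ p j₀ → Primitive p → All (λ x → 1 ≤ x) p → 0 < length p →
    (∀ i → i < length p → rot j₀ p ≡ rot i p ⊎ rot j₀ p <lex rot i p) →
    IsLyndonComposition (sum (rot j₀ p)) (rot j₀ p)
  least-rotation-lyndon p j₀ prim positive 0<len least =
    All-rot j₀ p positive , refl , primitive⇒aperiodic ℓ prim-ℓ ,
    λ i 0<i i< → subst (ℓ <lex_) (rot≡drop++take i ℓ (<⇒≤ i<)) (ℓ<rot i 0<i i<)
    where
    ℓ = rot j₀ p
    prim-ℓ : Primitive ℓ
    prim-ℓ = primitive-rot p prim j₀
    ℓ<rot : ∀ i → 0 < i → i < length ℓ → ℓ <lex rot i ℓ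
    ℓ<rot i 0<i i< with rot-mod-length (j₀ + i) p 0<len
    ... | t , t< , rot≡ with least t t<
    ...   | inj₁ ℓ≡ = ⊥-elim (prim-ℓ i 0<i i< (trans (sym (rot-+ j₀ i p)) (trans rot≡ (sym ℓ≡))))
    ...   | inj₂ ℓ< = subst (ℓ <lex_) (sym (trans (sym (rot-+ j₀ i p)) rot≡)) ℓ<

  rot-inverse : ∀ (p : List ℕ) j₀ → j₀ < length p → Σ ℕ λ j → j < length p × rot j (rot j₀ p) ≡ p
  rot-inverse p zero      0<len = 0 , 0<len , refl
  rot-inverse p (suc j₀) j₀<len =
    length p ∸ suc j₀ , ∸-monoʳ-< {length p} (s≤s z≤n) (<⇒≤ j₀<len) , rot∸-inverse (suc j₀) p (<⇒≤ j₀<len)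

  0<length-root : ∀ {a p : List ℕ} q → a ≢ [] → a ≡ power q p → 0 < length p
  0<length-root {p = []}    q a≢[] a≡ = ⊥-elim (a≢[] (trans a≡ (power-[] q)))
  0<length-root {p = _ ∷ _} q _    _  = s≤s z≤n

  module _ {m : ℕ} (1≤m : 1 ≤ m) where

    unroll-surjective : ∀ a → IsCompositionℕ m a → Σ (ℕ × List ℕ × ℕ) λ x → LyndonRotation m x × unroll m x ≡ a
    unroll-surjective a (positive , sum≡m) with primitive-root _≟_ a a≢[]
      where
      a≢[] : a ≢ []
      a≢[] refl = <-irrefl sum≡m 1≤m
    ... | p , q , prim , 1≤q , a≡
      with least-rotation p (length p) (0<length-root q (λ { refl → <-irrefl sum≡m 1≤m }) a≡)
    ... | j₀ , j₀< , least with rot-inverse p j₀ j₀<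
    ... | j , j< , rot≡p = (sum ℓ , ℓ , j) , (L , j<ℓ , q , dq≡m) ,
                           trans (unroll-LyndonRotation 1≤m L j<ℓ dq≡m) (trans (cong (power q) rot≡p) (sym a≡))
      where
      ℓ = rot j₀ p
      j<ℓ : j < length ℓ
      j<ℓ = subst (j <_) (sym (length-rot j₀ p)) j<
      L : IsLyndonComposition (sum ℓ) ℓ
      L = least-rotation-lyndon p j₀ prim (All-power⁻ q p 1≤q (subst (All (λ x → 1 ≤ x)) a≡ positive))
            (≤-<-trans z≤n j₀<) least
      dq≡m : sum ℓ * q ≡ m
      dq≡m = trans (*-comm (sum ℓ) q)
               (trans (cong (q *_) (sum-rot j₀ p)) (trans (sym (sum-power q p)) (trans (cong sum (sym a≡)) sum≡m)))

  sum-head₀-drop : ∀ ℓ → sum (applyUpTo (λ j → head₀ (drop j ℓ)) (length ℓ)) ≡ sum ℓ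
  sum-head₀-drop []      = refl
  sum-head₀-drop (x ∷ ℓ) = cong (x +_) (sum-head₀-drop ℓ)

  sumOver-rotations : ∀ (ℓ : List ℕ) c → SumOver (λ j → j < length ℓ) (λ j → head₀ (rot j ℓ) * c) (sum ℓ * c)
  sumOver-rotations ℓ c =
    sumOver-congᶠ head₀-rot (subst (SumOver (_< length ℓ) (λ j → c * head₀ (drop j ℓ))) c*sum
      (sumOver-*ˡ c (sumOver-upTo (length ℓ) (λ j → head₀ (drop j ℓ)))))
    where
    head₀-rot : ∀ {j} → j < length ℓ → c * head₀ (drop j ℓ) ≡ head₀ (rot j ℓ) * c
    head₀-rot {j} j< = trans (*-comm c _) (cong (_* c) (sym (trans (cong head₀ (rot≡drop++take j ℓ (<⇒≤ j<)))
      (head₀-++ (drop j ℓ) (take j ℓ) (subst (0 <_) (sym (length-drop j ℓ)) (m<n⇒0<n∸m j<))))))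
    c*sum : c * sum (map (λ j → head₀ (drop j ℓ)) (upTo (length ℓ))) ≡ sum ℓ * c
    c*sum = trans (cong (λ xs → c * sum xs) (map-applyUpTo (λ j → j) (λ j → head₀ (drop j ℓ)) (length ℓ)))
                  (trans (cong (c *_) (sum-head₀-drop ℓ)) (*-comm c (sum ℓ)))

  lyndon-[1] : IsLyndonComposition 1 [ 1 ]
  lyndon-[1] = (s≤s z≤n ∷ []) , refl , aperiodic , λ { zero () _ ; (suc j) _ (s≤s ()) }
    where
    aperiodic : Aperiodic [ 1 ]
    aperiodic ([] , k , _ , _ , [1]≡) with trans [1]≡ (power-[] k)
    ... | ()
    aperiodic (_ ∷ _ , k , s≤s () , _ , _)

  lyndon-[1]-unique : ∀ ℓ → IsLyndonComposition 1 ℓ → ℓ ≡ [ 1 ]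
  lyndon-[1]-unique []               (_ , () , _)
  lyndon-[1]-unique (suc zero ∷ [])  _ = refl
  lyndon-[1]-unique (suc zero ∷ y ∷ ℓ) ((_ ∷ 1≤y ∷ _) , sum≡1 , _) = ⊥-elim (<-irrefl (sym (suc-injective sum≡1)) (≤-trans 1≤y (m≤m+n y (sum ℓ))))
  lyndon-[1]-unique (suc (suc x) ∷ ℓ) (_ , () , _)
  lyndon-[1]-unique (zero ∷ ℓ)      ((() ∷ _) , _)

  rotationWeight : ℕ → ℕ × List ℕ × ℕ → ℕ
  rotationWeight m (d , ℓ , j) = head₀ (rot j ℓ) * weight ℓ ^ quotient m d

  module _ {m : ℕ} (1≤m : 1 ≤ m) (s : ℕ → ℕ)
           (sum-lyndon : ∀ d q → d * q ≡ m → 1 < d → SumOver (IsLyndonComposition d) (λ a → weight a ^ q) (s d))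
           {t : ℕ} (sum-divisors : SumOver (λ d → (d ∣ m) × (1 < d)) (λ d → d * s d) t) where

    sumOver-LyndonRotation : SumOver (LyndonRotation m) (rotationWeight m) (suc t)
    sumOver-LyndonRotation = subst (SumOver (LyndonRotation m) (rotationWeight m)) (cong (_+ t) weight-trivial)
      (sumOver-cong to-rotation from-rotation (sumOver-insert trivial (λ { ((_ , s≤s ()) , _) })
        (sumOver-Σ sum-divisors per-divisor)))
      where
      per-divisor : ∀ {d} → d ∣ m × 1 < d →
        SumOver (λ (ℓj : List ℕ × ℕ) → IsLyndonComposition d (proj₁ ℓj) × proj₂ ℓj < length (proj₁ ℓj))
                (λ (ℓj : List ℕ × ℕ) → rotationWeight m (d , ℓj)) (d * s d)
      per-divisor {d} (divides q m≡ , 1<d) = sumOver-Σ (sumOver-*ˡ d (sum-lyndon d q dq≡m 1<d)) λ {ℓ} L →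
        sumOver-congᶠ (λ {j} _ → cong (λ k → head₀ (rot j ℓ) * weight ℓ ^ k) (sym (quotient-exact d q dq≡m (<⇒≤ 1<d))))
          (subst (SumOver (_< length ℓ) (λ j → head₀ (rot j ℓ) * weight ℓ ^ q)) (cong (_* (weight ℓ ^ q)) (proj₁ (proj₂ L)))
            (sumOver-rotations ℓ (weight ℓ ^ q)))
        where
        dq≡m : d * q ≡ m
        dq≡m = trans (*-comm d q) (sym m≡)
      trivial : ℕ × List ℕ × ℕ
      trivial = 1 , [ 1 ] , 0
      weight-trivial : rotationWeight m trivial ≡ 1
      weight-trivial = trans (+-identityʳ _) (^-zeroˡ (quotient m 1))
      Nontrivial : ℕ × List ℕ × ℕ → Set
      Nontrivial (d , ℓ , j) = (d ∣ m × 1 < d) × (IsLyndonComposition d ℓ × j < length ℓ)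
      to-rotation : ∀ {x} → x ≡ trivial ⊎ Nontrivial x → LyndonRotation m x
      to-rotation (inj₁ refl) = lyndon-[1] , s≤s z≤n , m , +-identityʳ m
      to-rotation {d , _} (inj₂ ((divides q m≡ , _) , L , j<)) = L , j< , q , trans (*-comm d q) (sym m≡)
      from-rotation : ∀ {x} → LyndonRotation m x → x ≡ trivial ⊎ Nontrivial x
      from-rotation {zero , _}          (_ , _ , q , refl) = ⊥-elim (<-irrefl refl 1≤m)
      from-rotation {suc zero , ℓ , j}  (L , j< , _) with lyndon-[1]-unique ℓ L | j<
      ... | refl | s≤s z≤n = inj₁ refl
      from-rotation {suc (suc d) , _} (L , j< , q , dq≡m) =
        inj₂ ((divides q (trans (sym dq≡m) (*-comm (suc (suc d)) q)) , s≤s (s≤s z≤n)) , L , j<)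

    sumOver-head-weight : SumOver (IsCompositionℕ m) (λ a → head₀ a * weight a) (suc t)
    sumOver-head-weight =
      sumOver-cong (λ { (x , Rx , refl) → unroll-IsCompositionℕ 1≤m Rx }) (unroll-surjective 1≤m _)
        (sumOver-image {f = λ a → head₀ a * weight a} (unroll m) (unroll-injective 1≤m)
          (sumOver-congᶠ (λ Rx → sym (head₀-weight-unroll 1≤m Rx)) sumOver-LyndonRotation))


module WheelWords where

  open import Data.Nat using (ℕ; zero; suc; _+_; _∸_; _≤_; _<_; z≤n; s≤s)
  open import Data.Nat.Properties
  open import Data.List using (List; []; _∷_; _++_; length; take; [_])
  open import Data.List.Properties using (length-++)
  open import Data.Maybe using (Maybe; just; nothing; fromMaybe)
  open import Data.Maybe.Properties using (just-injective)
  open import Data.Bool using (Bool; true; false; if_then_else_)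
  open import Relation.Binary.PropositionalEquality hiding ([_])
  open import Data.Product using (Σ; _×_; _,_; proj₁; proj₂)
  open import Data.Sum using (inj₁; inj₂)
  open import Data.Empty
  open import Data.Unit using (⊤; tt)
  open import Relation.Nullary using (¬_; yes; no)
  open import Relation.Binary.Definitions using (DecidableEquality; tri<; tri≈; tri>)
  import Data.Nat

  -- The letter of rim vertex r: C for the block of the centre, S for the block of cpred m r,
  -- N for a new block.
  data Letter : Set where
    C S N : Letter

  _≟L_ : DecidableEquality Letter
  C ≟L C = yes refl
  C ≟L S = no λ ()
  C ≟L N = no λ ()
  S ≟L C = no λ ()
  S ≟L S = yes refl
  S ≟L N = no λ ()
  N ≟L C = no λ ()
  N ≟L S = no λ ()
  N ≟L N = yes refl

  -- Positions beyond the end read as S.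
  at : List Letter → ℕ → Letter
  at [] _ = S
  at (x ∷ w) zero = x
  at (x ∷ w) (suc r) = at w r

  Allowed : Letter → Letter → Set
  Allowed C S = ⊥
  Allowed C C = ⊤
  Allowed C N = ⊤
  Allowed S _ = ⊤
  Allowed N _ = ⊤

  NoCS : List Letter → Set
  NoCS [] = ⊤
  NoCS (x ∷ []) = ⊤
  NoCS (x ∷ y ∷ l) = Allowed x y × NoCS (y ∷ l)

  NoCS⇒at : ∀ l r → NoCS l → suc r < length l → at l (suc r) ≡ S → at l r ≢ C
  NoCS⇒at (x ∷ []) zero _ (s≤s ())
  NoCS⇒at (x ∷ []) (suc r) _ (s≤s ())
  NoCS⇒at (x ∷ y ∷ l) zero (o , _) _ eS eC rewrite eS | eC = o
  NoCS⇒at (x ∷ y ∷ l) (suc r) (_ , n) (s≤s lt) eS eC = NoCS⇒at (y ∷ l) r n lt eS eC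

  at⇒NoCS : ∀ l → (∀ r → suc r < length l → at l (suc r) ≡ S → at l r ≢ C) → NoCS l
  at⇒NoCS [] h = tt
  at⇒NoCS (x ∷ []) h = tt
  at⇒NoCS (x ∷ y ∷ l) h = allowed x y (h 0 (s≤s (s≤s z≤n))) , at⇒NoCS (y ∷ l) (λ r lt → h (suc r) (s≤s lt))
    where
    allowed : ∀ x y → (y ≡ S → x ≢ C) → Allowed x y
    allowed C S f = f refl refl
    allowed C C f = tt
    allowed C N f = tt
    allowed S _ f = tt
    allowed N _ f = tt

  at-++ˡ : ∀ xs ys r → r < length xs → at (xs ++ ys) r ≡ at xs r
  at-++ˡ (x ∷ xs) ys zero _ = refl
  at-++ˡ (x ∷ xs) ys (suc r) (s≤s lt) = at-++ˡ xs ys r lt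

  at-++ʳ : ∀ xs ys r → at (xs ++ ys) (length xs + r) ≡ at ys r
  at-++ʳ [] ys r = refl
  at-++ʳ (x ∷ xs) ys r = at-++ʳ xs ys r

  cpred : ℕ → ℕ → ℕ
  cpred m zero = m ∸ 1
  cpred m (suc r) = r

  cpred< : ∀ m r → r < m → cpred m r < m
  cpred< m zero    0<m = ∸-monoʳ-< {m} (s≤s z≤n) 0<m
  cpred< m (suc r) r<m = <-trans (n<1+n r) r<m

  -- An S right after a C would put its vertex in the block of the centre, whose letter is C.
  CyclicNoCS : List Letter → Set
  CyclicNoCS w = NoCS (w ++ take 1 w)

  CyclicNoCS⇒at : ∀ w r → CyclicNoCS w → r < length w → at w r ≡ S → at w (cpred (length w) r) ≢ C
  CyclicNoCS⇒at w (suc r) v lt eS eC =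
    NoCS⇒at (w ++ take 1 w) r v (≤-trans lt (≤-trans (m≤m+n (length w) (length (take 1 w))) (≤-reflexive (sym (length-++ w)))))
      (trans (at-++ˡ w (take 1 w) (suc r) lt) eS) (trans (at-++ˡ w (take 1 w) r (<⇒≤ lt)) eC)
  CyclicNoCS⇒at (x ∷ w') zero v lt eS eC =
    NoCS⇒at ((x ∷ w') ++ [ x ]) (length w') v
      (s≤s (≤-reflexive (sym (trans (length-++ w') (+-comm (length w') 1)))))
      (trans (cong (λ z → at (w' ++ [ x ]) z) (sym (+-identityʳ (length w')))) (trans (at-++ʳ w' [ x ] 0) eS))
      (trans (at-++ˡ (x ∷ w') [ x ] (length w') ≤-refl) eC)

  at⇒CyclicNoCS : ∀ w → (∀ r → r < length w → at w r ≡ S → at w (cpred (length w) r) ≢ C) → CyclicNoCS w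
  at⇒CyclicNoCS [] h = tt
  at⇒CyclicNoCS (x ∷ w') h = at⇒NoCS ((x ∷ w') ++ [ x ]) g
    where
    m = suc (length w')
    lenl : length ((x ∷ w') ++ [ x ]) ≡ suc m
    lenl = cong suc (trans (length-++ w') (+-comm (length w') 1))
    g : ∀ r → suc r < length ((x ∷ w') ++ [ x ]) → at ((x ∷ w') ++ [ x ]) (suc r) ≡ S → at ((x ∷ w') ++ [ x ]) r ≢ C
    g r lt eS eC with m≤n⇒m<n∨m≡n (≤-pred (subst (suc r <_) lenl lt))
    ... | inj₁ lt' = h (suc r) lt' (trans (sym (at-++ˡ (x ∷ w') [ x ] (suc r) lt')) eS)
                       (trans (sym (at-++ˡ (x ∷ w') [ x ] r (<⇒≤ lt'))) eC)
    ... | inj₂ e with e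
    ...   | refl = h 0 (s≤s z≤n)
                     (trans (sym (at-++ʳ w' [ x ] 0)) (trans (cong (at (w' ++ [ x ])) (+-identityʳ (length w'))) eS))
                     (trans (sym (at-++ˡ (x ∷ w') [ x ] (length w') ≤-refl)) eC)

  ≡S⇒≢N : ∀ {x} → x ≡ S → x ≢ N
  ≡S⇒≢N refl ()

  ≡S⇒≢C : ∀ {x} → x ≡ S → x ≢ C
  ≡S⇒≢C refl ()

  ≡N⇒≢C : ∀ {x} → x ≡ N → x ≢ C
  ≡N⇒≢C refl ()

  ≤-suc-extend : ∀ {P : ℕ → Set} {i k} → (i ≤ k → P i) → P (suc k) → i ≤ suc k → P i
  ≤-suc-extend {i = i} {k} below at-suc i≤ with m≤n⇒m<n∨m≡n i≤
  ... | inj₁ i<  = below (≤-pred i<)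
  ... | inj₂ refl = at-suc

  isN : Letter → Bool
  isN N = true
  isN C = false
  isN S = false

  lastN : List Letter → ℕ → Maybe ℕ
  lastN w zero = if isN (at w 0) then just 0 else nothing
  lastN w (suc k) = if isN (at w (suc k)) then just (suc k) else lastN w k

  lastN-N : ∀ w k → at w k ≡ N → lastN w k ≡ just k
  lastN-N w zero e rewrite e = refl
  lastN-N w (suc k) e rewrite e = refl

  lastN-¬N : ∀ w k → at w (suc k) ≢ N → lastN w (suc k) ≡ lastN w k
  lastN-¬N w k ne with at w (suc k)
  ... | C = refl
  ... | S = refl
  ... | N = ⊥-elim (ne refl)

  lastN0-¬N : ∀ w → at w 0 ≢ N → lastN w 0 ≡ nothing
  lastN0-¬N w ne with at w 0
  ... | C = refl
  ... | S = refl
  ... | N = ⊥-elim (ne refl)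

  lastN-just : ∀ w k s → lastN w k ≡ just s → s ≤ k × at w s ≡ N × (∀ i → s < i → i ≤ k → at w i ≢ N)
  lastN-just w k s e with at w k ≟L N
  ... | yes atN with just-injective (trans (sym (lastN-N w k atN)) e)
  ...   | refl = ≤-refl , atN , λ i s<i i≤s _ → <-irrefl refl (<-≤-trans s<i i≤s)
  lastN-just w zero s e | no ¬N with trans (sym (lastN0-¬N w ¬N)) e
  ... | ()
  lastN-just w (suc k) s e | no ¬N with lastN-just w k s (trans (sym (lastN-¬N w k ¬N)) e)
  ... | s≤k , atN , later = m≤n⇒m≤1+n s≤k , atN , λ i s<i i≤ → ≤-suc-extend {λ i → at w i ≢ N} (later i s<i) ¬N i≤

  lastN-nothing : ∀ w k → lastN w k ≡ nothing → ∀ i → i ≤ k → at w i ≢ N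
  lastN-nothing w k e i i≤k with at w k ≟L N
  ... | yes atN with trans (sym (lastN-N w k atN)) e
  ...   | ()
  lastN-nothing w zero    e zero z≤n | no ¬N = ¬N
  lastN-nothing w (suc k) e i    i≤k | no ¬N =
    ≤-suc-extend {λ i → at w i ≢ N} (lastN-nothing w k (trans (sym (lastN-¬N w k ¬N)) e) i) ¬N i≤k

  lastN-intro : ∀ w k s → at w s ≡ N → s ≤ k → (∀ i → s < i → i ≤ k → at w i ≢ N) → lastN w k ≡ just s
  lastN-intro w k s e le h with m≤n⇒m<n∨m≡n le
  ... | inj₂ refl = lastN-N w s e
  ... | inj₁ lt with k
  ...   | suc k' = trans (lastN-¬N w k' (h (suc k') lt ≤-refl)) (lastN-intro w k' s e (≤-pred lt) (λ i a b → h i a (m≤n⇒m≤1+n b)))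

  lastN-none : ∀ w k → (∀ i → i ≤ k → at w i ≢ N) → lastN w k ≡ nothing
  lastN-none w zero h = lastN0-¬N w (h 0 z≤n)
  lastN-none w (suc k) h = trans (lastN-¬N w k (h (suc k) ≤-refl)) (lastN-none w k (λ i le → h i (m≤n⇒m≤1+n le)))

  -- The N starting the block of r: the last N at or before r, else the last N of the word, else 0.
  blockStart : List Letter → ℕ → ℕ
  blockStart w r = fromMaybe (fromMaybe 0 (lastN w (length w ∸ 1))) (lastN w r)

  isC : Letter → Bool
  isC C = true
  isC S = false
  isC N = false

  label : List Letter → ℕ → ℕ
  label w r = if isC (at w r) then 0 else suc (blockStart w r)

  countN : List Letter → ℕ
  countN [] = 0
  countN (N ∷ w) = suc (countN w)
  countN (C ∷ w) = countN w
  countN (S ∷ w) = countN w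

  CFree : List Letter → Set
  CFree w = ∀ r → r < length w → at w r ≢ C

  -- In a C-free word with a single N all rim vertices form one block, so that N would lie in
  -- the block of its predecessor.
  NotLoneN : List Letter → Set
  NotLoneN w = CFree w → countN w ≢ 1

  WheelWord : ℕ → List Letter → Set
  WheelWord m w = length w ≡ m × CyclicNoCS w × NotLoneN w

  nonCN⇒S : ∀ x → x ≢ C → x ≢ N → x ≡ S
  nonCN⇒S C a b = ⊥-elim (a refl)
  nonCN⇒S S a b = refl
  nonCN⇒S N a b = ⊥-elim (b refl)

  module BlockStart (w : List Letter) (cyc : CyclicNoCS w) (E : ℕ → ℕ → Set) (Erefl : ∀ a → E a a)
               (Etrans : ∀ {a b c} → E a b → E b c → E a c)
               (step : ∀ r → r < length w → at w r ≡ S → E r (cpred (length w) r)) where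

    reach-lastN : ∀ r → r < length w → at w r ≢ C → ∀ s → lastN w r ≡ just s → E r s
    reach-lastN r lt nc s e with at w r in eq
    ... | C = ⊥-elim (nc refl)
    ... | N = subst (E r) (just-injective (trans (sym (lastN-N w r eq)) e)) (Erefl r)
    ... | S = helper r lt eq e
      where
      helper : ∀ r → r < length w → at w r ≡ S → lastN w r ≡ just s → E r s
      helper zero lt eq e with trans (sym (lastN0-¬N w (≡S⇒≢N eq))) e
      ... | ()
      helper (suc r') lt eq e =
        Etrans (step (suc r') lt eq)
          (reach-lastN r' (<-trans (n<1+n r') lt) (CyclicNoCS⇒at w (suc r') cyc lt eq) s
            (trans (sym (lastN-¬N w r' (≡S⇒≢N eq))) e))

    reach-0 : ∀ r → r < length w → at w r ≢ C → lastN w r ≡ nothing → E r 0 × at w 0 ≢ C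
    reach-0 zero lt nc e = Erefl 0 , nc
    reach-0 (suc r) lt nc e with at w (suc r) in eq
    ... | C = ⊥-elim (nc refl)
    reach-0 (suc r) lt nc () | N
    ... | S with reach-0 r (<-trans (n<1+n r) lt) (CyclicNoCS⇒at w (suc r) cyc lt eq) e
    ...   | a , b = Etrans (step (suc r) lt eq) a , b

    reach-blockStart : ∀ r → r < length w → at w r ≢ C → E r (blockStart w r)
    reach-blockStart r lt nc with lastN w r in e1
    ... | just s = reach-lastN r lt nc s e1
    ... | nothing with lastN w (length w ∸ 1) in e2
    ...   | nothing = proj₁ (reach-0 r lt nc e1)
    ...   | just s = Etrans (proj₁ cb) (Etrans (step 0 m>0 at0S) (reach-lastN (length w ∸ 1) m-1< (CyclicNoCS⇒at w 0 cyc m>0 at0S) s e2))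
      where
      cb = reach-0 r lt nc e1
      m>0 : 0 < length w
      m>0 = ≤-<-trans z≤n lt
      at0S : at w 0 ≡ S
      at0S = nonCN⇒S (at w 0) (proj₂ cb) (lastN-nothing w r e1 0 z≤n)
      m-1< : length w ∸ 1 < length w
      m-1< = ∸-monoʳ-< {length w} {1} {0} (s≤s z≤n) m>0

  blockStart-S : ∀ w r → at w r ≡ S → blockStart w r ≡ blockStart w (cpred (length w) r)
  blockStart-S w (suc r) eq = cong (fromMaybe (fromMaybe 0 (lastN w (length w ∸ 1)))) (lastN-¬N w r (≡S⇒≢N eq))
  blockStart-S w zero eq rewrite lastN0-¬N w (≡S⇒≢N eq) with lastN w (length w ∸ 1)
  ... | just s = refl
  ... | nothing = refl

  countN≡0 : ∀ w → (∀ i → i < length w → at w i ≡ S) → countN w ≡ 0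
  countN≡0 [] h = refl
  countN≡0 (x ∷ w) h with h 0 (s≤s z≤n)
  ... | refl = countN≡0 w (λ i lt → h (suc i) (s≤s lt))

  countN≡0⇒¬N : ∀ w → countN w ≡ 0 → ∀ i → at w i ≢ N
  countN≡0⇒¬N [] e i ()
  countN≡0⇒¬N (N ∷ w) () i
  countN≡0⇒¬N (C ∷ w) e zero ()
  countN≡0⇒¬N (C ∷ w) e (suc i) = countN≡0⇒¬N w e i
  countN≡0⇒¬N (S ∷ w) e zero ()
  countN≡0⇒¬N (S ∷ w) e (suc i) = countN≡0⇒¬N w e i

  countN≡1 : ∀ w r → r < length w → at w r ≡ N → (∀ i → i < length w → i ≢ r → at w i ≡ S) → countN w ≡ 1
  countN≡1 (x ∷ w) zero lt e h rewrite e = cong suc (countN≡0 w (λ i lt' → h (suc i) (s≤s lt') (λ ())))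
  countN≡1 (x ∷ w) (suc r) (s≤s lt) e h with h 0 (s≤s z≤n) (λ ())
  ... | refl = countN≡1 w r lt e (λ i lt' ne → h (suc i) (s≤s lt') (λ e' → ne (suc-injective e')))

  countN≡1⇒ : ∀ w → countN w ≡ 1 → Σ ℕ λ r → r < length w × at w r ≡ N × (∀ i → i < length w → i ≢ r → at w i ≢ N)
  countN≡1⇒ [] ()
  countN≡1⇒ (N ∷ w) e = 0 , s≤s z≤n , refl , λ { zero _ ne → ⊥-elim (ne refl) ; (suc i) _ _ → countN≡0⇒¬N w (suc-injective e) i }
  countN≡1⇒ (C ∷ w) e with countN≡1⇒ w e
  ... | r , lt , eN , h = suc r , s≤s lt , eN , λ { zero _ _ () ; (suc i) (s≤s lt') ne → h i lt' (λ e' → ne (cong suc e')) }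
  countN≡1⇒ (S ∷ w) e with countN≡1⇒ w e
  ... | r , lt , eN , h = suc r , s≤s lt , eN , λ { zero _ _ () ; (suc i) (s≤s lt') ne → h i lt' (λ e' → ne (cong suc e')) }

  module Descend (w : List Letter) (cyc : CyclicNoCS w) where
    all-S-below : ∀ k → k < length w → at w k ≡ S → (∀ i → i ≤ k → at w i ≢ N) → ∀ i → i ≤ k → at w i ≡ S
    all-S-below zero lt e h zero z≤n = e
    all-S-below (suc k) lt e h i le with m≤n⇒m<n∨m≡n le
    ... | inj₂ refl = e
    ... | inj₁ l = all-S-below k (<-trans (n<1+n k) lt)
                     (nonCN⇒S (at w k) (CyclicNoCS⇒at w (suc k) cyc lt e) (h k (n≤1+n k)))
                     (λ j le' → h j (m≤n⇒m≤1+n le')) i (≤-pred l)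

    all-S-between : ∀ r k → r < k → k < length w → at w k ≡ S → (∀ i → r < i → i ≤ k → at w i ≢ N) →
            ∀ i → r < i → i ≤ k → at w i ≡ S
    all-S-between r (suc k) r<k lt e h i ri le with m≤n⇒m<n∨m≡n le
    ... | inj₂ refl = e
    ... | inj₁ l with m≤n⇒m<n∨m≡n (≤-pred r<k)
    ...   | inj₂ refl = ⊥-elim (<-irrefl refl (<-≤-trans ri (≤-pred l)))
    ...   | inj₁ r<k' = all-S-between r k r<k' (<-trans (n<1+n k) lt)
                     (nonCN⇒S (at w k) (CyclicNoCS⇒at w (suc k) cyc lt e) (h k r<k' (n≤1+n k)))
                     (λ j a b → h j a (m≤n⇒m≤1+n b)) i ri (≤-pred l)

  <⇒≤∸1 : ∀ {i m} → i < m → i ≤ m ∸ 1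
  <⇒≤∸1 {i} {m} lt = subst (i ≤_) (pred[m∸n]≡m∸[1+n] m 0) (suc[m]≤n⇒m≤pred[n] lt)

  ∸1< : ∀ {m} → 0 < m → m ∸ 1 < m
  ∸1< {suc m} _ = s≤s ≤-refl

  top-S : ∀ w r → CyclicNoCS w → 0 < length w → (∀ i → r < i → i ≤ length w ∸ 1 → at w i ≢ N) → at w (length w ∸ 1) ≢ C →
         ∀ i → r < i → i < length w → at w i ≡ S
  top-S w r cyc m>0 hN hC i ri im = all-S-between r (length w ∸ 1) r<m-1 (∸1< m>0)
                (nonCN⇒S _ hC (hN (length w ∸ 1) r<m-1 ≤-refl)) hN i ri (<⇒≤∸1 im)
    where
    open Descend w cyc
    r<m-1 : r < length w ∸ 1
    r<m-1 = <-≤-trans ri (<⇒≤∸1 im)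

  lone-N-contradiction : ∀ w r → r < length w → at w r ≡ N → NotLoneN w → (∀ i → i < length w → i ≢ r → at w i ≡ S) → ⊥
  lone-N-contradiction w r lt eN lone allS = lone noC (countN≡1 w r lt eN allS)
    where
    noC : CFree w
    noC i i< eC with i Data.Nat.≟ r
    ... | yes refl = ≡N⇒≢C eN eC
    ... | no ne = ≡S⇒≢C (allS i i< ne) eC

  -- If the block of the predecessor started at r it would run around the whole rim, leaving r as
  -- the only N of a C-free word.
  blockStart-cpred≢ : ∀ w r → CyclicNoCS w → NotLoneN w → r < length w → at w r ≡ N → at w (cpred (length w) r) ≢ C → blockStart w (cpred (length w) r) ≢ r
  blockStart-cpred≢ w zero cyc lone lt eN nc est with lastN w (length w ∸ 1) in e2
  ... | nothing = lastN-nothing w (length w ∸ 1) e2 0 z≤n eN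
  ... | just s with lastN-just w (length w ∸ 1) s e2
  ...   | _ , _ , hN rewrite est =
    lone-N-contradiction w 0 lt eN lone (λ i i< ne → top-S w 0 cyc lt hN nc i (n≢0⇒n>0 ne) i<)
  blockStart-cpred≢ w (suc r') cyc lone lt eN nc est with lastN w r' in e1
  ... | just s with lastN-just w r' s e1
  ...   | s≤r' , _ , _ = <-irrefl est (s≤s s≤r')
  blockStart-cpred≢ w (suc r') cyc lone lt eN nc est | nothing with lastN w (length w ∸ 1) in e2
  ...   | nothing = 0≢1+n est
  ...   | just s with lastN-just w (length w ∸ 1) s e2
  ...     | _ , _ , hN rewrite est = lone-N-contradiction w (suc r') lt eN lone case
      where
      open Descend w cyc
      m>0 : 0 < length w
      m>0 = ≤-<-trans z≤n lt
      lowS : ∀ i → i ≤ r' → at w i ≡ S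
      lowS = all-S-below r' (<-trans (n<1+n r') lt) (nonCN⇒S _ nc (lastN-nothing w r' e1 r' ≤-refl)) (lastN-nothing w r' e1)
      case : ∀ i → i < length w → i ≢ suc r' → at w i ≡ S
      case i i< ne with <-cmp i (suc r')
      ... | tri< a _ _ = lowS i (≤-pred a)
      ... | tri≈ _ b _ = ⊥-elim (ne b)
      ... | tri> _ _ c = top-S w (suc r') cyc m>0 hN (CyclicNoCS⇒at w 0 cyc m>0 (lowS 0 z≤n)) i c i<

  label-C : ∀ w r → at w r ≡ C → label w r ≡ 0
  label-C w r e rewrite e = refl

  label≡0⇒C : ∀ w r → label w r ≡ 0 → at w r ≡ C
  label≡0⇒C w r e with at w r
  ... | C = refl
  ... | S = ⊥-elim (1+n≢0 e)
  ... | N = ⊥-elim (1+n≢0 e)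

  label-¬C : ∀ w r → at w r ≢ C → label w r ≡ suc (blockStart w r)
  label-¬C w r ne with at w r
  ... | C = ⊥-elim (ne refl)
  ... | S = refl
  ... | N = refl

  label-S : ∀ w r → CyclicNoCS w → r < length w → at w r ≡ S → label w r ≡ label w (cpred (length w) r)
  label-S w r cyc lt eS = trans (label-¬C w r (≡S⇒≢C eS))
                     (trans (cong suc (blockStart-S w r eS)) (sym (label-¬C w (cpred (length w) r) (CyclicNoCS⇒at w r cyc lt eS))))


module PartitionCodes where

  open import Data.Nat using (ℕ; zero; suc; z≤n; s≤s)
  import Data.Nat as ℕ
  import Data.Nat.Properties as ℕ
  open import Data.Fin using (Fin; zero; suc; toℕ; _≤_)
  open import Data.Fin.Properties using (toℕ-injective)
  open import Data.Vec using (Vec; lookup; tabulate)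
  open import Data.Vec.Properties using (lookup∘tabulate; tabulate∘lookup; tabulate-cong)
  open import Data.Maybe using (Maybe; just; nothing)
  import Data.Maybe as Maybe
  open import Data.Maybe.Properties using (just-injective)
  open import Relation.Binary.PropositionalEquality
  open import Relation.Binary.Definitions using (DecidableEquality)
  open import Data.Product using (Σ; _×_; _,_; proj₁; proj₂)
  open import Relation.Nullary using (yes; no)
  open import Data.Empty using (⊥-elim)
  open import Function using (_∘_)
  open import Defs using (IsPartitionCode)

  module _ {A : Set} (_≟_ : DecidableEquality A) where


    firstIndex : ∀ {n} → (Fin n → A) → A → Maybe (Fin n)
    firstIndex {zero} f c = nothing
    firstIndex {suc n} f c with f zero ≟ c
    ... | yes _ = just zero
    ... | no _ = Maybe.map suc (firstIndex (f ∘ suc) c)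

    firstIndex-just : ∀ {n} (f : Fin n → A) c j → firstIndex f c ≡ just j → f j ≡ c × (∀ k → f k ≡ c → j ≤ k)
    firstIndex-just {suc n} f c j e with f zero ≟ c
    firstIndex-just {suc n} f c .zero refl | yes p = p , λ k _ → z≤n
    ... | no np with firstIndex (f ∘ suc) c in e2
    ...   | nothing with e
    ...     | ()
    firstIndex-just {suc n} f c j e | no np | just j' with e
    ...     | refl with firstIndex-just (f ∘ suc) c j' e2
    ...       | a , b = a , λ { zero fk → ⊥-elim (np fk) ; (suc k) fk → s≤s (b k fk) }

    firstIndex-total : ∀ {n} (f : Fin n → A) c k → f k ≡ c → Σ (Fin n) λ j → firstIndex f c ≡ just j
    firstIndex-total {suc n} f c k e with f zero ≟ c
    ... | yes _ = zero , refl
    ... | no np with k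
    ...   | zero = ⊥-elim (np e)
    ...   | suc k' with firstIndex-total (f ∘ suc) c k' e
    ...     | j , e2 rewrite e2 = suc j , refl

    canonical : ∀ {n} → (Fin n → A) → Fin n → Fin n
    canonical f i = proj₁ (firstIndex-total f (f i) i refl)

    module _ {n} (f : Fin n → A) where
      firstIndex-canonical : ∀ i → firstIndex f (f i) ≡ just (canonical f i)
      firstIndex-canonical i = proj₂ (firstIndex-total f (f i) i refl)

      canonical-fibre : ∀ i → f (canonical f i) ≡ f i
      canonical-fibre i = proj₁ (firstIndex-just f (f i) (canonical f i) (firstIndex-canonical i))

      canonical-least : ∀ i k → f k ≡ f i → canonical f i ≤ k
      canonical-least i = proj₂ (firstIndex-just f (f i) (canonical f i) (firstIndex-canonical i))

      canonical-cong : ∀ i k → f i ≡ f k → canonical f i ≡ canonical f k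
      canonical-cong i k e = just-injective (trans (sym (firstIndex-canonical i)) (trans (cong (firstIndex f) e) (firstIndex-canonical k)))

      canonical-reflects : ∀ i k → canonical f i ≡ canonical f k → f i ≡ f k
      canonical-reflects i k e = trans (sym (canonical-fibre i)) (trans (cong f e) (canonical-fibre k))

      partitionCode : Vec (Fin n) n
      partitionCode = tabulate (canonical f)

      lookup-partitionCode : ∀ i → lookup partitionCode i ≡ canonical f i
      lookup-partitionCode = lookup∘tabulate (canonical f)

      partitionCode-isPartitionCode : IsPartitionCode n partitionCode
      partitionCode-isPartitionCode i = subst (_≤ i) (sym (lookup-partitionCode i)) (canonical-least i i refl) ,
        trans (cong (lookup partitionCode) (lookup-partitionCode i)) (trans (lookup-partitionCode (canonical f i)) (trans (canonical-cong (canonical f i) i (canonical-fibre i)) (sym (lookup-partitionCode i))))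

      partitionCode-kernel : ∀ i j → lookup partitionCode i ≡ lookup partitionCode j → f i ≡ f j
      partitionCode-kernel i j e = canonical-reflects i j (trans (sym (lookup-partitionCode i)) (trans e (lookup-partitionCode j)))

      partitionCode-kernel⁻ : ∀ i j → f i ≡ f j → lookup partitionCode i ≡ lookup partitionCode j
      partitionCode-kernel⁻ i j e = trans (lookup-partitionCode i) (trans (canonical-cong i j e) (sym (lookup-partitionCode j)))

      partitionCode-unique : (v : Vec (Fin n) n) → IsPartitionCode n v →
                    (∀ i j → lookup v i ≡ lookup v j → f i ≡ f j) →
                    (∀ i j → f i ≡ f j → lookup v i ≡ lookup v j) → v ≡ partitionCode
      partitionCode-unique v pc h1 h2 = trans (sym (tabulate∘lookup v)) (tabulate-cong pt)
        where
        pt : ∀ i → lookup v i ≡ canonical f i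
        pt i = toℕ-injective (ℕ.≤-antisym u≤c c≤u)
          where
          c = canonical f i
          u = lookup v i
          vc : lookup v c ≡ u
          vc = h2 c i (canonical-fibre i)
          c≤u : toℕ c ℕ.≤ toℕ u
          c≤u = canonical-least i u (h1 u i (proj₂ (pc i)))
          u≤c : toℕ u ℕ.≤ toℕ c
          u≤c = subst (λ z → toℕ z ℕ.≤ toℕ c) vc (proj₁ (pc c))


module WheelCodes where

  open import Data.Nat using (ℕ; zero; suc; _∸_; z≤n; s≤s; _≟_)
  import Data.Nat as ℕ
  open import Data.Nat.Properties
  open import Data.Fin as Fin using (Fin; zero; suc; toℕ)
  open import Data.Fin.Properties using (toℕ-injective; toℕ<n)
  open import Data.Vec using (Vec; lookup)
  open import Data.List using (List; []; _∷_; length; map; upTo)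
  open import Data.List.Properties using (length-map; length-upTo)
  open import Relation.Binary.PropositionalEquality hiding ([_])
  open import Data.Product using (_×_; _,_; proj₁; proj₂)
  open import Data.Sum using (_⊎_; inj₁; inj₂)
  open import Data.Empty
  open import Relation.Nullary using (¬_; yes; no)
  open import Relation.Binary.Definitions using (tri<; tri≈; tri>)
  open import Function using (_∘_)
  open import Data.Maybe using (fromMaybe)
  open import Defs using (Walk; here; step; WheelAdj; WheelAdjℕ; IsComposition; HasCount)
  open FiniteSums
  open WheelWords
  open PartitionCodes

  -- Values above k are clamped to k; only r ≤ k is ever used.
  clamp : ∀ {k} → ℕ → Fin (suc k)
  clamp zero = zero
  clamp {zero} (suc r) = zero
  clamp {suc k} (suc r) = suc (clamp {k} r)

  toℕ-clamp : ∀ {k} r → r ℕ.≤ k → toℕ (clamp {k} r) ≡ r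
  toℕ-clamp zero _ = refl
  toℕ-clamp {suc k} (suc r) (s≤s le) = cong suc (toℕ-clamp r le)

  clamp-toℕ : ∀ {k} (y : Fin (suc k)) → clamp {k} (toℕ y) ≡ y
  clamp-toℕ {k} y = toℕ-injective (toℕ-clamp (toℕ y) (ℕ.s≤s⁻¹ (toℕ<n y)))

  module _ {n : ℕ} {Adj : Fin n → Fin n → Set} where

    walk-++ : ∀ {P : Fin n → Set} {x y z} → Walk Adj P x y → Walk Adj P y z → Walk Adj P x z
    walk-++ (here _)       q = q
    walk-++ (step px a p)  q = step px a (walk-++ p q)

    walk-start : ∀ {P : Fin n → Set} {x y} → Walk Adj P x y → P x
    walk-start (here p)     = p
    walk-start (step p _ _) = p

    walk-map : ∀ {P Q : Fin n → Set} → (∀ x → P x → Q x) → ∀ {x y} → Walk Adj P x y → Walk Adj Q x y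
    walk-map f (here p)     = here (f _ p)
    walk-map f (step p a w) = step (f _ p) a (walk-map f w)

    walk-reverse : ∀ {P : Fin n → Set} → (∀ {i j} → Adj i j → Adj j i) → ∀ {x y} → Walk Adj P x y → Walk Adj P y x
    walk-reverse sym-adj (here p)       = here p
    walk-reverse sym-adj (step px a w) = walk-++ (walk-reverse sym-adj w) (step (walk-start w) (sym-adj a) (here px))

  WheelAdjℕ-sym : ∀ n {a b} → WheelAdjℕ n a b → WheelAdjℕ n b a
  WheelAdjℕ-sym n (inj₁ x)                                   = inj₂ (inj₁ x)
  WheelAdjℕ-sym n (inj₂ (inj₁ x))                            = inj₁ x
  WheelAdjℕ-sym n (inj₂ (inj₂ (inj₁ x)))                     = inj₂ (inj₂ (inj₂ (inj₁ x)))
  WheelAdjℕ-sym n (inj₂ (inj₂ (inj₂ (inj₁ x))))              = inj₂ (inj₂ (inj₁ x))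
  WheelAdjℕ-sym n (inj₂ (inj₂ (inj₂ (inj₂ (inj₁ (x , y , z)))))) = inj₂ (inj₂ (inj₂ (inj₂ (inj₂ (x , y , z ∘ sym)))))
  WheelAdjℕ-sym n (inj₂ (inj₂ (inj₂ (inj₂ (inj₂ (x , y , z)))))) = inj₂ (inj₂ (inj₂ (inj₂ (inj₁ (x , y , z ∘ sym)))))

  module WheelGraph (m : ℕ) where
    n = suc m
    rim : ℕ → Fin (suc m)
    rim r = clamp {m} (suc r)

    toℕ-rim : ∀ r → r ℕ.< m → toℕ (rim r) ≡ suc r
    toℕ-rim r lt = toℕ-clamp (suc r) lt

    Adj = WheelAdj n

    adj-rim-pred : ∀ r → suc r ℕ.< m → Adj (rim (suc r)) (rim r)
    adj-rim-pred r lt rewrite toℕ-rim (suc r) lt | toℕ-rim r (<-trans (n<1+n r) lt) =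
      inj₂ (inj₂ (inj₂ (inj₁ ((λ ()) , refl))))

    adj-rim-wrap : 1 ℕ.< m → Adj (rim 0) (rim (m ∸ 1))
    adj-rim-wrap lt rewrite toℕ-rim 0 (<-trans (s≤s z≤n) lt) | toℕ-rim (m ∸ 1) (∸1< (<-trans (s≤s z≤n) lt)) =
      inj₂ (inj₂ (inj₂ (inj₂ (inj₁ (refl , m-1+1 m (<-trans (s≤s z≤n) lt) , λ e → <-irrefl (trans e (m-1+1 m (<-trans (s≤s z≤n) lt))) lt)))))
      where
      m-1+1 : ∀ m → 0 ℕ.< m → suc (m ∸ 1) ≡ m
      m-1+1 (suc m) _ = refl

  clamp-suc-toℕ : ∀ {k} (y : Fin k) → clamp {k} (suc (toℕ y)) ≡ suc y
  clamp-suc-toℕ {suc k} y = cong suc (clamp-toℕ y)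

  labelFin : ∀ {k} → List Letter → Fin (suc k) → ℕ
  labelFin w zero = 0
  labelFin w (suc y) = label w (toℕ y)

  labelFin-rim : ∀ {k} w r → r ℕ.< k → labelFin {k} w (clamp {k} (suc r)) ≡ label w r
  labelFin-rim {suc k} w r (s≤s le) = cong (label w) (toℕ-clamp r le)

  module Decode (m : ℕ) where
    open WheelGraph m public

    vertexLabel : List Letter → Fin (suc m) → ℕ
    vertexLabel = labelFin {m}

    decode : List Letter → Vec (Fin (suc m)) (suc m)
    decode w = partitionCode _≟_ (vertexLabel w)

    module DecodeComposition (w : List Letter) (length≡ : length w ≡ m) (cyc : CyclicNoCS w) where
      CyclicNoCS⇒at-m : ∀ r → r ℕ.< m → at w r ≡ S → at w (cpred m r) ≢ C
      CyclicNoCS⇒at-m r lt e rewrite sym length≡ = CyclicNoCS⇒at w r cyc lt e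

      Joined : ℕ → ℕ → Set
      Joined a b = a ℕ.< m → (b ℕ.< m × label w a ≡ label w b × Walk Adj (λ z → vertexLabel w z ≡ label w a) (rim a) (rim b))

      Joined-refl : ∀ a → Joined a a
      Joined-refl a lt = lt , refl , here (labelFin-rim w a lt)

      Joined-trans : ∀ {a b c} → Joined a b → Joined b c → Joined a c
      Joined-trans {a} {b} {c} eab ebc lt with eab lt
      ... | lb , label-a≡b , wab with ebc lb
      ...   | lc , lab-bc , wbc = lc , trans label-a≡b lab-bc ,
              walk-++ wab (walk-map (λ z e → trans e (sym label-a≡b)) wbc)

      walk-cpred : ∀ {c} r → r ℕ.< m → vertexLabel w (rim r) ≡ c → vertexLabel w (rim (cpred m r)) ≡ c → Walk Adj (λ z → vertexLabel w z ≡ c) (rim r) (rim (cpred m r))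
      walk-cpred (suc r') lt' Pr' Ppr' = step Pr' (adj-rim-pred r' lt') (here Ppr')
      walk-cpred {c} zero lt' Pr' Ppr' with <-cmp 1 m
      ... | tri< a _ _ = step Pr' (adj-rim-wrap a) (here Ppr')
      ... | tri≈ _ b _ = subst (λ z → Walk Adj (λ z → vertexLabel w z ≡ c) (rim 0) (rim (z ∸ 1))) b (here Pr')
      ... | tri> _ _ c' = ⊥-elim (<-irrefl refl (<-≤-trans lt' (≤-pred c')))

      Joined-cpred : ∀ r → at w r ≡ S → Joined r (cpred m r)
      Joined-cpred r eS lt = cpred< m r lt , label≡ , walk-r
        where
        label≡ : label w r ≡ label w (cpred m r)
        label≡ = trans (label-¬C w r (≡S⇒≢C eS))
                     (trans (cong suc (trans (blockStart-S w r eS) (cong (λ z → blockStart w (cpred z r)) length≡)))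
                       (sym (label-¬C w (cpred m r) (CyclicNoCS⇒at-m r lt eS))))
        label-r : vertexLabel w (rim r) ≡ label w r
        label-r = labelFin-rim w r lt
        label-cpred : vertexLabel w (rim (cpred m r)) ≡ label w r
        label-cpred = trans (labelFin-rim w (cpred m r) (cpred< m r lt)) (sym label≡)
        walk-r : Walk Adj (λ z → vertexLabel w z ≡ label w r) (rim r) (rim (cpred m r))
        walk-r = walk-cpred r lt label-r label-cpred

      Joined-step : ∀ r → r ℕ.< length w → at w r ≡ S → Joined r (cpred (length w) r)
      Joined-step r _ eS = subst (λ z → Joined r (cpred z r)) (sym length≡) (Joined-cpred r eS)

      open BlockStart w cyc Joined Joined-refl Joined-trans Joined-step

      walk-blockStart : ∀ r → r ℕ.< m → at w r ≢ C → Walk Adj (λ z → vertexLabel w z ≡ label w r) (rim r) (rim (blockStart w r))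
      walk-blockStart r lt nc = proj₂ (proj₂ (reach-blockStart r (subst (r ℕ.<_) (sym length≡) lt) nc lt))

      walk-centre : ∀ x → vertexLabel w x ≡ 0 → Walk Adj (λ z → vertexLabel w z ≡ 0) x zero
      walk-centre zero e = here refl
      walk-centre (suc y) e = step e (inj₂ (inj₁ (refl , λ ()))) (here refl)

      walk-label : ∀ i j → vertexLabel w i ≡ vertexLabel w j → Walk Adj (λ z → vertexLabel w z ≡ vertexLabel w i) i j
      walk-label i j e with vertexLabel w i in ei
      ... | zero = walk-++ (walk-centre i ei) (walk-reverse (WheelAdjℕ-sym n) (walk-centre j (sym e)))
      walk-label (suc y) (suc y') e | suc k =
        subst₂ (Walk Adj (λ z → vertexLabel w z ≡ suc k)) (clamp-suc-toℕ y) (clamp-suc-toℕ y')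
          (walk-map (λ z e' → trans e' label-a) (walk-++ (walk-blockStart a (toℕ<n y) a≢C)
             (subst (λ t → Walk Adj (λ z → vertexLabel w z ≡ label w a) (rim t) (rim b)) (sym blockStart≡)
               (walk-reverse (WheelAdjℕ-sym n) (walk-map (λ z e' → trans e' (sym label-a≡b)) (walk-blockStart b (toℕ<n y') b≢C))))))
        where
        a = toℕ y
        b = toℕ y'
        label-a : label w a ≡ suc k
        label-a = ei
        label-a≡b : label w a ≡ label w b
        label-a≡b = trans label-a e
        a≢C : at w a ≢ C
        a≢C eC = 0≢1+n (trans (sym (label-C w a eC)) label-a)
        b≢C : at w b ≢ C
        b≢C eC = 0≢1+n (trans (sym (label-C w b eC)) (sym e))
        blockStart≡ : blockStart w a ≡ blockStart w b
        blockStart≡ = suc-injective (trans (sym (label-¬C w a a≢C)) (trans label-a≡b (label-¬C w b b≢C)))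

      decode-isComposition : IsComposition (suc m) (WheelAdj (suc m)) (decode w)
      decode-isComposition = partitionCode-isPartitionCode _≟_ (vertexLabel w) , λ i j e →
        walk-map (λ z e' → partitionCode-kernel⁻ _≟_ (vertexLabel w) z i e') (walk-label i j (partitionCode-kernel _≟_ (vertexLabel w) i j e))

  at-map-upTo : ∀ (g : ℕ → Letter) k r → r ℕ.< k → at (map g (upTo k)) r ≡ g r
  at-map-upTo g k r lt = go (λ i → i) k r lt
    where
    go : ∀ (h : ℕ → ℕ) k r → r ℕ.< k → at (map g (Data.List.applyUpTo h k)) r ≡ g (h r)
    go h (suc k) zero _ = refl
    go h (suc k) (suc r) (s≤s lt) = go (λ i → h (suc i)) k r lt

  length-map-upTo : ∀ (g : ℕ → Letter) k → length (map g (upTo k)) ≡ k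
  length-map-upTo g k = trans (length-map g (upTo k)) (length-upTo k)

  at-extensionality : ∀ (xs ys : List Letter) → length xs ≡ length ys → (∀ r → r ℕ.< length xs → at xs r ≡ at ys r) → xs ≡ ys
  at-extensionality [] [] _ _ = refl
  at-extensionality (x ∷ xs) (y ∷ ys) e h = cong₂ _∷_ (h 0 (s≤s z≤n)) (at-extensionality xs ys (suc-injective e) (λ r lt → h (suc r) (s≤s lt)))

  module Encode (m : ℕ) where
    open Decode m public

    PartitionCode = Vec (Fin (suc m)) (suc m)

    block : PartitionCode → ℕ → ℕ
    block v r = toℕ (lookup v (rim r))

    letterOf : PartitionCode → ℕ → Letter
    letterOf v r with block v r ≟ 0
    ... | yes _ = C
    ... | no _ with block v r ≟ block v (cpred m r)
    ...   | yes _ = S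
    ...   | no _ = N

    encode : PartitionCode → List Letter
    encode v = map (letterOf v) (upTo m)

    length-encode : ∀ v → length (encode v) ≡ m
    length-encode v = length-map-upTo (letterOf v) m

    at-encode : ∀ v r → r ℕ.< m → at (encode v) r ≡ letterOf v r
    at-encode v r lt = at-map-upTo (letterOf v) m r lt

    letterOf-C : ∀ v r → block v r ≡ 0 → letterOf v r ≡ C
    letterOf-C v r e with block v r ≟ 0
    ... | yes _ = refl
    ... | no ne = ⊥-elim (ne e)

    letterOf-S : ∀ v r → block v r ≢ 0 → block v r ≡ block v (cpred m r) → letterOf v r ≡ S
    letterOf-S v r n0 e with block v r ≟ 0
    ... | yes z = ⊥-elim (n0 z)
    ... | no _ with block v r ≟ block v (cpred m r)
    ...   | yes _ = refl
    ...   | no ne = ⊥-elim (ne e)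

    letterOf-N : ∀ v r → block v r ≢ 0 → block v r ≢ block v (cpred m r) → letterOf v r ≡ N
    letterOf-N v r n0 ne with block v r ≟ 0
    ... | yes z = ⊥-elim (n0 z)
    ... | no _ with block v r ≟ block v (cpred m r)
    ...   | yes e = ⊥-elim (ne e)
    ...   | no _ = refl

    letterOf-C⁻ : ∀ v r → letterOf v r ≡ C → block v r ≡ 0
    letterOf-C⁻ v r e with block v r ≟ 0
    ... | yes z = z
    ... | no _ with block v r ≟ block v (cpred m r)
    letterOf-C⁻ v r () | no _ | yes _
    letterOf-C⁻ v r () | no _ | no _

    letterOf-S⁻ : ∀ v r → letterOf v r ≡ S → block v r ≢ 0 × block v r ≡ block v (cpred m r)
    letterOf-S⁻ v r e with block v r ≟ 0
    letterOf-S⁻ v r () | yes z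
    ... | no n0 with block v r ≟ block v (cpred m r)
    ...   | yes q = n0 , q
    letterOf-S⁻ v r () | no n0 | no _

    letterOf-N⁻ : ∀ v r → letterOf v r ≡ N → block v r ≢ 0 × block v r ≢ block v (cpred m r)
    letterOf-N⁻ v r e with block v r ≟ 0
    letterOf-N⁻ v r () | yes z
    ... | no n0 with block v r ≟ block v (cpred m r)
    letterOf-N⁻ v r () | no n0 | yes q
    ...   | no nq = n0 , nq

    module EncodeDecode (w : List Letter) (length≡ : length w ≡ m) (cyc : CyclicNoCS w) (lone : NotLoneN w) where
      open DecodeComposition w length≡ cyc using (CyclicNoCS⇒at-m)
      v = decode w

      lookup-centre : lookup v zero ≡ zero
      lookup-centre = toℕ-injective (n≤0⇒n≡0 (proj₁ (partitionCode-isPartitionCode _≟_ (vertexLabel w) zero)))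

      label-S-m : ∀ r → r ℕ.< m → at w r ≡ S → label w r ≡ label w (cpred m r)
      label-S-m r lt eS = trans (label-¬C w r (≡S⇒≢C eS))
                     (trans (cong suc (trans (blockStart-S w r eS) (cong (λ z → blockStart w (cpred z r)) length≡)))
                       (sym (label-¬C w (cpred m r) (CyclicNoCS⇒at-m r lt eS))))

      label-N-m : ∀ r → r ℕ.< m → at w r ≡ N → label w r ≢ label w (cpred m r)
      label-N-m r lt eN e = cs (at w (cpred m r)) refl
        where
        labr : label w r ≡ suc r
        labr = trans (label-¬C w r (≡N⇒≢C eN)) (cong (λ z → suc (fromMaybe _ z)) (lastN-N w r eN))
        nC : ∀ x → at w (cpred m r) ≡ x → x ≢ C → ⊥
        nC x ep xnC = blockStart-cpred≢ w r cyc lone (subst (r ℕ.<_) (sym length≡) lt) eN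
                  (subst (λ z → at w (cpred z r) ≢ C) (sym length≡) (λ e' → xnC (trans (sym ep) e')))
                  (trans (cong (λ z → blockStart w (cpred z r)) length≡)
                    (suc-injective (trans (sym (label-¬C w (cpred m r) (λ e' → xnC (trans (sym ep) e')))) (trans (sym e) labr))))
        cs : ∀ x → at w (cpred m r) ≡ x → ⊥
        cs C ep = 0≢1+n (trans (sym (trans e (label-C w (cpred m r) ep))) labr)
        cs S ep = nC S ep (λ ())
        cs N ep = nC N ep (λ ())

      block≡⇒label≡ : ∀ a b → a ℕ.< m → b ℕ.< m → block v a ≡ block v b → label w a ≡ label w b
      block≡⇒label≡ a b label-a lb e = trans (sym (labelFin-rim w a label-a)) (trans (partitionCode-kernel _≟_ (vertexLabel w) (rim a) (rim b) (toℕ-injective e)) (labelFin-rim w b lb))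

      label≡⇒block≡ : ∀ a b → a ℕ.< m → b ℕ.< m → label w a ≡ label w b → block v a ≡ block v b
      label≡⇒block≡ a b label-a lb e = cong toℕ (partitionCode-kernel⁻ _≟_ (vertexLabel w) (rim a) (rim b) (trans (labelFin-rim w a label-a) (trans e (sym (labelFin-rim w b lb)))))

      block≡0⇒label≡0 : ∀ a → a ℕ.< m → block v a ≡ 0 → label w a ≡ 0
      block≡0⇒label≡0 a label-a e = trans (sym (labelFin-rim w a label-a)) (partitionCode-kernel _≟_ (vertexLabel w) (rim a) zero (trans (toℕ-injective e) (sym lookup-centre)))

      label≡0⇒block≡0 : ∀ a → a ℕ.< m → label w a ≡ 0 → block v a ≡ 0
      label≡0⇒block≡0 a label-a e = cong toℕ (trans (partitionCode-kernel⁻ _≟_ (vertexLabel w) (rim a) zero (trans (labelFin-rim w a label-a) e)) lookup-centre)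

      letterOf-decode : ∀ r → r ℕ.< m → letterOf v r ≡ at w r
      letterOf-decode r lt with at w r in er
      ... | C = letterOf-C v r (label≡0⇒block≡0 r lt (label-C w r er))
      ... | S = letterOf-S v r (λ z → ≡S⇒≢C er (label≡0⇒C w r (block≡0⇒label≡0 r lt z)))
                  (label≡⇒block≡ r (cpred m r) lt (cpred< m r lt) (label-S-m r lt er))
      ... | N = letterOf-N v r (λ z → ≡N⇒≢C er (label≡0⇒C w r (block≡0⇒label≡0 r lt z)))
                  (λ e → label-N-m r lt er (block≡⇒label≡ r (cpred m r) lt (cpred< m r lt) e))

      encode-decode : encode (decode w) ≡ w
      encode-decode = at-extensionality (encode v) w (trans (length-encode v) (sym length≡))
                  (λ r lt → let lt' = subst (r ℕ.<_) (length-encode v) lt in trans (at-encode v r lt') (letterOf-decode r lt'))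

    rim-adjacent : ∀ c c' → WheelAdjℕ (suc m) (suc c) (suc c') →
            c' ≡ suc c ⊎ c ≡ suc c' ⊎ (c ≡ 0 × c' ≡ m ∸ 1) ⊎ (c' ≡ 0 × c ≡ m ∸ 1)
    rim-adjacent c c' (inj₁ (() , _))
    rim-adjacent c c' (inj₂ (inj₁ (() , _)))
    rim-adjacent c c' (inj₂ (inj₂ (inj₁ (_ , e)))) = inj₁ (suc-injective e)
    rim-adjacent c c' (inj₂ (inj₂ (inj₂ (inj₁ (_ , e))))) = inj₂ (inj₁ (suc-injective e))
    rim-adjacent c c' (inj₂ (inj₂ (inj₂ (inj₂ (inj₁ (e1 , e2 , _)))))) = inj₂ (inj₂ (inj₁ (suc-injective e1 , cong (_∸ 1) e2)))
    rim-adjacent c c' (inj₂ (inj₂ (inj₂ (inj₂ (inj₂ (e1 , e2 , _)))))) = inj₂ (inj₂ (inj₂ (suc-injective e1 , cong (_∸ 1) e2)))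

    module DecodeEncode (v : PartitionCode) (comp : IsComposition (suc m) (WheelAdj (suc m)) v) where
      w = encode v
      length≡ : length w ≡ m
      length≡ = length-encode v
      isPartition = proj₁ comp

      lookup-centre : lookup v zero ≡ zero
      lookup-centre = toℕ-injective (n≤0⇒n≡0 (proj₁ (isPartition zero)))

      <length : ∀ {r} → r ℕ.< m → r ℕ.< length w
      <length {r} = subst (r ℕ.<_) (sym length≡)

      cpred-length : ∀ r → cpred (length w) r ≡ cpred m r
      cpred-length r = cong (λ z → cpred z r) length≡

      cyc : CyclicNoCS w
      cyc = at⇒CyclicNoCS w h
        where
        h : ∀ r → r ℕ.< length w → at w r ≡ S → at w (cpred (length w) r) ≢ C
        h r lt eS eC with letterOf-S⁻ v r (trans (sym (at-encode v r lt')) eS)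
          where lt' = subst (r ℕ.<_) length≡ lt
        ... | n0 , eq = n0 (trans eq (letterOf-C⁻ v (cpred m r) (trans (sym (at-encode v (cpred m r) (cpred< m r lt'))) (trans (cong (at w) (sym (cpred-length r))) eC))))
          where lt' = subst (r ℕ.<_) length≡ lt

      Joined : ℕ → ℕ → Set
      Joined a b = block v a ≡ block v b

      Joined-step : ∀ r → r ℕ.< length w → at w r ≡ S → Joined r (cpred (length w) r)
      Joined-step r lt eS = trans (proj₂ (letterOf-S⁻ v r (trans (sym (at-encode v r lt')) eS))) (cong (block v) (sym (cpred-length r)))
        where lt' = subst (r ℕ.<_) length≡ lt

      open BlockStart w cyc Joined (λ a → refl) trans Joined-step

      blockStart-cpred-lone : ∀ r → r ℕ.< length w → at w r ≡ N → (∀ i → i ℕ.< length w → i ≢ r → at w i ≢ N) → blockStart w (cpred (length w) r) ≡ r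
      blockStart-cpred-lone zero lt eN hN rewrite lastN-intro w (length w ∸ 1) 0 eN z≤n
                           (λ i 0<i le → hN i (≤-<-trans le (∸1< lt)) (λ e → <-irrefl (sym e) 0<i)) = refl
      blockStart-cpred-lone (suc r) lt eN hN rewrite lastN-none w r (λ i le → hN i (<-trans (s≤s le) lt) (λ e → <-irrefl e (s≤s le)))
                               | lastN-intro w (length w ∸ 1) (suc r) eN (<⇒≤∸1 lt)
                                   (λ i ri le → hN i (≤-<-trans le (∸1< (≤-<-trans z≤n lt))) (λ e → <-irrefl (sym e) ri)) = refl

      lone : NotLoneN w
      lone noC e1 with countN≡1⇒ w e1
      ... | r , lt , eN , hN = proj₂ (letterOf-N⁻ v r (trans (sym (at-encode v r lt')) eN))
                                (sym (trans (cong (block v) (sym (cpred-length r))) (trans (reach-blockStart (cpred (length w) r) (cpred<length r lt) (noC (cpred (length w) r) (cpred<length r lt))) (cong (block v) (blockStart-cpred-lone r lt eN hN)))))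
        where
        lt' = subst (r ℕ.<_) length≡ lt
        cpred<length : ∀ r → r ℕ.< length w → cpred (length w) r ℕ.< length w
        cpred<length r lt = subst (λ z → cpred z r ℕ.< z) (sym length≡) (cpred< m r (subst (r ℕ.<_) length≡ lt))

      label-S-m : ∀ r → r ℕ.< m → at w r ≡ S → label w r ≡ label w (cpred m r)
      label-S-m r lt eS = trans (label-S w r cyc (<length lt) eS) (cong (label w) (cpred-length r))

      at-S : ∀ r → r ℕ.< m → block v r ≢ 0 → block v r ≡ block v (cpred m r) → at w r ≡ S
      at-S r lt n0 e = trans (at-encode v r lt) (letterOf-S v r n0 e)

      label-adjacent : ∀ c c' → c ℕ.< m → c' ℕ.< m → block v c ≡ block v c' → block v c ≢ 0 →
               (c' ≡ suc c ⊎ c ≡ suc c' ⊎ (c ≡ 0 × c' ≡ m ∸ 1) ⊎ (c' ≡ 0 × c ≡ m ∸ 1)) → label w c ≡ label w c'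
      label-adjacent c .(suc c) lc lc' e n0 (inj₁ refl) = sym (label-S-m (suc c) lc' (at-S (suc c) lc' (λ z → n0 (trans e z)) (sym e)))
      label-adjacent .(suc c') c' lc lc' e n0 (inj₂ (inj₁ refl)) = label-S-m (suc c') lc (at-S (suc c') lc n0 e)
      label-adjacent .0 .(m ∸ 1) lc lc' e n0 (inj₂ (inj₂ (inj₁ (refl , refl)))) = label-S-m 0 lc (at-S 0 lc n0 e)
      label-adjacent .(m ∸ 1) .0 lc lc' e n0 (inj₂ (inj₂ (inj₂ (refl , refl)))) =
        sym (label-S-m 0 lc' (at-S 0 lc' (λ z → n0 (trans e z)) (sym e)))

      block-rim : ∀ (c : Fin m) → block v (toℕ c) ≡ toℕ (lookup v (suc c))
      block-rim c = cong (λ z → toℕ (lookup v z)) (clamp-suc-toℕ c)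

      walk-label-constant : ∀ {β x x'} → Walk (WheelAdj (suc m)) (λ z → lookup v z ≡ β) x x' → β ≢ zero → vertexLabel w x ≡ vertexLabel w x'
      walk-label-constant (here _) nz = refl
      walk-label-constant {β} (step {zero} bi a rest) nz = ⊥-elim (nz (trans (sym bi) lookup-centre))
      walk-label-constant {β} (step {suc c} {zero} bi a rest) nz = ⊥-elim (nz (trans (sym (walk-start rest)) lookup-centre))
      walk-label-constant {β} (step {suc c} {suc c'} bi a rest) nz =
        trans (label-adjacent (toℕ c) (toℕ c') (toℕ<n c) (toℕ<n c')
                (trans (block-rim c) (trans (cong toℕ (trans bi (sym (walk-start rest)))) (sym (block-rim c'))))
                (λ z → nz (trans (sym bi) (toℕ-injective (trans (sym (block-rim c)) z))))
                (rim-adjacent (toℕ c) (toℕ c') a))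
              (walk-label-constant rest nz)

      centre-block⇒label≡0 : ∀ x → lookup v x ≡ zero → vertexLabel w x ≡ 0
      centre-block⇒label≡0 zero _ = refl
      centre-block⇒label≡0 (suc c) e = label-C w (toℕ c) (trans (at-encode v (toℕ c) (toℕ<n c)) (letterOf-C v (toℕ c) (trans (block-rim c) (cong toℕ e))))

      label≡0⇒centre-block : ∀ x → vertexLabel w x ≡ 0 → lookup v x ≡ zero
      label≡0⇒centre-block zero _ = lookup-centre
      label≡0⇒centre-block (suc c) e = toℕ-injective (trans (sym (block-rim c))
                        (letterOf-C⁻ v (toℕ c) (trans (sym (at-encode v (toℕ c) (toℕ<n c))) (label≡0⇒C w (toℕ c) e))))

      same-block⇒same-label : ∀ x y → lookup v x ≡ lookup v y → vertexLabel w x ≡ vertexLabel w y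
      same-block⇒same-label x y e with lookup v x Fin.≟ zero
      ... | yes z = trans (centre-block⇒label≡0 x z) (sym (centre-block⇒label≡0 y (trans (sym e) z)))
      ... | no nz = walk-label-constant (proj₂ comp x y e) nz

      same-label⇒same-block : ∀ x y → vertexLabel w x ≡ vertexLabel w y → lookup v x ≡ lookup v y
      same-label⇒same-block x y e with vertexLabel w x ≟ 0
      ... | yes z = trans (label≡0⇒centre-block x z) (sym (label≡0⇒centre-block y (trans (sym e) z)))
      same-label⇒same-block zero y e | no nz = ⊥-elim (nz refl)
      same-label⇒same-block (suc c) zero e | no nz = ⊥-elim (nz e)
      same-label⇒same-block (suc c) (suc c') e | no nz =
        toℕ-injective (trans (sym (block-rim c)) (trans block≡ (block-rim c')))
        where
        a = toℕ c
        b = toℕ c'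
        a≢C : at w a ≢ C
        a≢C eC = nz (label-C w a eC)
        b≢C : at w b ≢ C
        b≢C eC = nz (trans e (label-C w b eC))
        blockStart≡ : blockStart w a ≡ blockStart w b
        blockStart≡ = suc-injective (trans (sym (label-¬C w a a≢C)) (trans e (label-¬C w b b≢C)))
        block≡ : block v a ≡ block v b
        block≡ = trans (reach-blockStart a (<length (toℕ<n c)) a≢C) (trans (cong (block v) blockStart≡) (sym (reach-blockStart b (<length (toℕ<n c')) b≢C)))

      decode-encode : decode (encode v) ≡ v
      decode-encode = sym (partitionCode-unique _≟_ (vertexLabel w) v isPartition same-block⇒same-label same-label⇒same-block)


  count-compositions : ∀ m {K} → HasCount (WheelWord m) K → HasCount (IsComposition (suc m) (WheelAdj (suc m))) K
  count-compositions m count-words =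
    sumOver-cong (λ { (w , (length≡ , cyc , _) , refl) → DecodeComposition.decode-isComposition w length≡ cyc })
                 (λ {v} comp → encode v , (DecodeEncode.length≡ v comp , DecodeEncode.cyc v comp , DecodeEncode.lone v comp) ,
                               DecodeEncode.decode-encode v comp)
      (sumOver-image {f = λ _ → 1} decode decode-injective count-words)
    where
    open Encode m
    decode-injective : ∀ {w w′} → WheelWord m w → WheelWord m w′ → decode w ≡ decode w′ → w ≡ w′
    decode-injective {w} {w′} (length≡ , cyc , lone) (length≡′ , cyc′ , lone′) decode≡ =
      trans (sym (EncodeDecode.encode-decode w length≡ cyc lone))
        (trans (cong encode decode≡) (EncodeDecode.encode-decode w′ length≡′ cyc′ lone′))


module Counting where

  open import Data.Nat using (ℕ; zero; suc; _+_; _*_; _∸_; _≤_; _<_; z≤n; s≤s; _^_; _≟_)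
  open import Data.Nat.Properties
  open import Data.List using (List; []; _∷_; _++_; length; map; [_]; replicate; take; drop)
  open import Data.List.Properties using (length-++; length-map; length-replicate; ++-assoc; ++-identityʳ; ∷-injective)
  open import Data.List.Relation.Unary.All using (All; []; _∷_)
  import Data.List.Relation.Unary.All as All
  import Data.List.Relation.Unary.All.Properties as AllP
  open import Data.List.Relation.Unary.Any using (here; there)
  open import Data.List.Membership.Propositional using (_∈_)
  open import Data.List.Membership.Propositional.Properties
  import Data.List.Relation.Unary.Unique.Propositional.Properties as UP
  open import Data.List.Relation.Unary.Unique.Propositional using (Unique)
  open import Data.List.Relation.Binary.Permutation.Propositional using (↭-sym)
  open import Data.List.Relation.Binary.Permutation.Propositional.Properties using (∈-resp-↭)
  open import Relation.Binary.PropositionalEquality hiding ([_])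
  open import Relation.Binary.Definitions using (tri<; tri≈; tri>)
  open import Data.Product using (Σ; ∃; _×_; _,_; proj₁; proj₂)
  open import Data.Sum using (_⊎_; inj₁; inj₂)
  open import Data.Empty
  open import Data.Unit using (⊤; tt)
  open import Relation.Nullary using (¬_; yes; no)
  import Data.List.Relation.Unary.AllPairs as AP
  open import Function.Bundles using (mk⇔)
  open import Data.Nat.ListAction using (sum)
  open import Defs
  open FiniteSums
  open Rotations
  open LyndonWords
  open WheelWords
  open WheelCodes
  open import Data.List.Membership.DecPropositional _≟L_ using (_∈?_)


  NotC : Letter → Set
  NotC x = x ≢ C

  wordsSN : ℕ → List (List Letter)
  wordsSN zero = [ [] ]
  wordsSN (suc k) = map (S ∷_) (wordsSN k) ++ map (N ∷_) (wordsSN k)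

  IsSNWord : ℕ → List Letter → Set
  IsSNWord k w = length w ≡ k × All NotC w

  length-wordsSN : ∀ k → length (wordsSN k) ≡ 2 ^ k
  length-wordsSN zero = refl
  length-wordsSN (suc k) = trans (length-++ (map (S ∷_) (wordsSN k)))
    (trans (cong₂ _+_ (length-map (S ∷_) (wordsSN k)) (length-map (N ∷_) (wordsSN k)))
      (trans (cong (λ z → z + z) (length-wordsSN k)) (cong (2 ^ k +_) (sym (+-identityʳ (2 ^ k))))))

  wordsSN-unique : ∀ k → Unique (wordsSN k)
  wordsSN-unique zero = [] AP.∷ AP.[]
  wordsSN-unique (suc k) = UP.++⁺ (UP.map⁺ (λ { refl → refl }) (wordsSN-unique k)) (UP.map⁺ (λ { refl → refl }) (wordsSN-unique k))
    (λ { (m1 , m2) → case (∈-map⁻ (S ∷_) m1) (∈-map⁻ (N ∷_) m2) })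
    where
    case : ∀ {v} → (∃ λ x → x ∈ wordsSN k × v ≡ S ∷ x) → (∃ λ x → x ∈ wordsSN k × v ≡ N ∷ x) → ⊥
    case (_ , _ , refl) (_ , _ , ())

  wordsSN-sound : ∀ k w → w ∈ wordsSN k → IsSNWord k w
  wordsSN-sound zero .[] (here refl) = refl , []
  wordsSN-sound (suc k) w m with ∈-++⁻ (map (S ∷_) (wordsSN k)) m
  ... | inj₁ m1 with ∈-map⁻ (S ∷_) m1
  ...   | x , x∈ , refl = let (l , a) = wordsSN-sound k x x∈ in cong suc l , (λ ()) ∷ a
  wordsSN-sound (suc k) w m | inj₂ m2 with ∈-map⁻ (N ∷_) m2
  ...   | x , x∈ , refl = let (l , a) = wordsSN-sound k x x∈ in cong suc l , (λ ()) ∷ a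

  wordsSN-complete : ∀ k w → IsSNWord k w → w ∈ wordsSN k
  wordsSN-complete zero [] _ = here refl
  wordsSN-complete (suc k) (C ∷ w) (l , (nc ∷ a)) = ⊥-elim (nc refl)
  wordsSN-complete (suc k) (S ∷ w) (l , (_ ∷ a)) = ∈-++⁺ˡ (∈-map⁺ (S ∷_) (wordsSN-complete k w (suc-injective l , a)))
  wordsSN-complete (suc k) (N ∷ w) (l , (_ ∷ a)) = ∈-++⁺ʳ (map (S ∷_) (wordsSN k)) (∈-map⁺ (N ∷_) (wordsSN-complete k w (suc-injective l , a)))


  count-SNWords : ∀ k → HasCount (IsSNWord k) (2 ^ k)
  count-SNWords k = wordsSN k , wordsSN-unique k , (λ w → mk⇔ (wordsSN-sound k w) (wordsSN-complete k w)) , trans (sum-map-const-1 (wordsSN k)) (length-wordsSN k)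

  loneN : ℕ → ℕ → List Letter
  loneN m i = replicate i S ++ N ∷ replicate (m ∸ suc i) S

  at-replicate-S-++ˡ : ∀ i (ys : List Letter) r → r < i → at (replicate i S ++ ys) r ≡ S
  at-replicate-S-++ˡ (suc i) ys zero _ = refl
  at-replicate-S-++ˡ (suc i) ys (suc r) (s≤s lt) = at-replicate-S-++ˡ i ys r lt

  at-replicate-S-++ʳ : ∀ i (ys : List Letter) r → at (replicate i S ++ ys) (i + r) ≡ at ys r
  at-replicate-S-++ʳ zero ys r = refl
  at-replicate-S-++ʳ (suc i) ys r = at-replicate-S-++ʳ i ys r

  at-replicate-S : ∀ k r → at (replicate k S) r ≡ S
  at-replicate-S zero r = refl
  at-replicate-S (suc k) zero = refl
  at-replicate-S (suc k) (suc r) = at-replicate-S k r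

  countN-replicate-S : ∀ k → countN (replicate k S) ≡ 0
  countN-replicate-S zero = refl
  countN-replicate-S (suc k) = countN-replicate-S k

  countN-S*NS* : ∀ i k → countN (replicate i S ++ N ∷ replicate k S) ≡ 1
  countN-S*NS* zero k = cong suc (countN-replicate-S k)
  countN-S*NS* (suc i) k = countN-S*NS* i k

  countN-loneN : ∀ m i → countN (loneN m i) ≡ 1
  countN-loneN m i = countN-S*NS* i (m ∸ suc i)

  length-loneN : ∀ m i → i < m → length (loneN m i) ≡ m
  length-loneN m i lt = trans (length-++ (replicate i S)) (trans (cong₂ _+_ (length-replicate i) (cong suc (length-replicate (m ∸ suc i))))
    (trans (+-suc i (m ∸ suc i)) (m+[n∸m]≡n lt)))

  loneN-NotC : ∀ m i → All NotC (loneN m i)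
  loneN-NotC m i = AllP.++⁺ (rep i) ((λ ()) ∷ rep (m ∸ suc i))
    where rep : ∀ k → All NotC (replicate k S)
          rep zero = []
          rep (suc k) = (λ ()) ∷ rep k

  at-loneN-i : ∀ m i → at (loneN m i) i ≡ N
  at-loneN-i m i = trans (cong (at (loneN m i)) (sym (+-identityʳ i))) (at-replicate-S-++ʳ i (N ∷ replicate (m ∸ suc i) S) 0)

  at-loneN-j : ∀ m i j → j ≢ i → at (loneN m i) j ≡ S
  at-loneN-j m i j ne with <-cmp j i
  ... | tri< a _ _ = at-replicate-S-++ˡ i _ j a
  ... | tri≈ _ b _ = ⊥-elim (ne b)
  ... | tri> _ _ c = trans (cong (at (loneN m i)) (sym (m+[n∸m]≡n (<⇒≤ c))))
                       (trans (at-replicate-S-++ʳ i _ (j ∸ i)) (lem (j ∸ i) (m<n⇒0<n∸m c)))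
    where lem : ∀ t → 0 < t → at (N ∷ replicate (m ∸ suc i) S) t ≡ S
          lem (suc t) _ = at-replicate-S (m ∸ suc i) t

  loneN-injective : ∀ m i j → loneN m i ≡ loneN m j → i ≡ j
  loneN-injective m i j e with i ≟ j
  ... | yes p = p
  ... | no ne = ⊥-elim (≡S⇒≢N (at-loneN-j m j i ne) (trans (cong (λ z → at z i) (sym e)) (at-loneN-i m i)))

  at-∈ : ∀ (w : List Letter) j → j < length w → at w j ∈ w
  at-∈ (x ∷ w) zero _ = here refl
  at-∈ (x ∷ w) (suc j) (s≤s l) = there (at-∈ w j l)

  at-beyond : ∀ (w : List Letter) j → length w ≤ j → at w j ≡ S
  at-beyond [] j _ = refl
  at-beyond (x ∷ w) (suc j) (s≤s l) = at-beyond w j l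

  loneN-complete : ∀ m w → IsSNWord m w → countN w ≡ 1 → Σ ℕ λ i → i < m × loneN m i ≡ w
  loneN-complete m w (length≡ , notC) count≡1 with countN≡1⇒ w count≡1
  ... | r , r< , atN , others = r , r<m , at-extensionality (loneN m r) w (trans (length-loneN m r r<m) (sym length≡)) (λ j _ → at≡ j)
    where
    r<m = subst (r <_) length≡ r<
    at≡ : ∀ j → at (loneN m r) j ≡ at w j
    at≡ j with j ≟ r
    ... | yes refl = trans (at-loneN-i m r) (sym atN)
    ... | no j≢r with <-cmp j (length w)
    ...   | tri< j<  _ _ = trans (at-loneN-j m r j j≢r) (sym (nonCN⇒S _ (All.lookup notC (at-∈ w j j<)) (others j j< j≢r)))
    ...   | tri≈ _ j≡ _ = trans (at-loneN-j m r j j≢r) (sym (at-beyond w j (≤-reflexive (sym j≡))))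
    ...   | tri> _ _ j> = trans (at-loneN-j m r j j≢r) (sym (at-beyond w j (<⇒≤ j>)))

  count-loneN-words : ∀ m → HasCount (λ w → IsSNWord m w × countN w ≡ 1) m
  count-loneN-words m =
    sumOver-cong (λ { (i , i< , refl) → (length-loneN m i i< , loneN-NotC m i) , countN-loneN m i })
                 (λ (sn , count≡1) → loneN-complete m _ sn count≡1)
      (sumOver-image {f = λ _ → 1} (loneN m) (λ _ _ → loneN-injective m _ _) (count-< m))

  count-SNWords-NotLoneN : ∀ m → HasCount (λ w → IsSNWord m w × countN w ≢ 1) (2 ^ m ∸ m)
  count-SNWords-NotLoneN m = count-complement (λ w → countN w ≟ 1) (count-SNWords m) (count-loneN-words m)

  NotStartS : List Letter → Set
  NotStartS [] = ⊤
  NotStartS (x ∷ _) = x ≢ S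

  -- A word containing C, rotated to end in C, is cut after each C into gaps: C-free words that
  -- are empty or start with N.
  IsGap : List Letter → Set
  IsGap g = All NotC g × NotStartS g

  IsGapOfLength : ℕ → List Letter → Set
  IsGapOfLength k g = IsGap g × length g ≡ k

  joinGaps : List (List Letter) → List Letter
  joinGaps [] = []
  joinGaps (g ∷ X) = g ++ C ∷ joinGaps X

  gapSizes : List (List Letter) → List ℕ
  gapSizes X = map (λ g → suc (length g)) X

  count-gaps : ∀ k → HasCount (IsGapOfLength k) (CP k)
  count-gaps zero = [ [] ] , [] AP.∷ AP.[] ,
    (λ g → mk⇔ (λ { (here refl) → ([] , tt) , refl }) (λ { (_ , e) → here (len0 g e) })) , refl
    where len0 : ∀ (g : List Letter) → length g ≡ 0 → g ≡ []
          len0 [] _ = refl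
  count-gaps (suc k) =
    sumOver-cong (λ { (y , (length≡ , notC) , refl) → (((λ ()) ∷ notC) , (λ ())) , cong suc length≡ }) (gap-tail _)
      (sumOver-image {f = λ _ → 1} (N ∷_) (λ { _ _ refl → refl }) (count-SNWords k))
    where
    gap-tail : ∀ g → IsGapOfLength (suc k) g → Σ (List Letter) λ y → IsSNWord k y × (N ∷ y) ≡ g
    gap-tail (C ∷ y) ((notC ∷ _ , _) , _) = ⊥-elim (notC refl)
    gap-tail (S ∷ y) ((_ , notS) , _)     = ⊥-elim (notS refl)
    gap-tail (N ∷ y) ((_ ∷ notC , _) , length≡) = y , (suc-injective length≡ , notC) , refl

  Decorates : List ℕ → List (List Letter) → Set
  Decorates a X = All IsGap X × gapSizes X ≡ a

  count-decorations : ∀ a → All (λ x → 1 ≤ x) a → HasCount (Decorates a) (weight a)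
  count-decorations [] _ = [ [] ] , [] AP.∷ AP.[] ,
    (λ X → mk⇔ (λ { (here refl) → [] , refl }) (λ { (_ , e) → here (nil X e) })) , refl
    where nil : ∀ (X : List (List Letter)) → gapSizes X ≡ [] → X ≡ []
          nil [] _ = refl
  count-decorations (x ∷ a) (1≤x ∷ positive) =
    subst (HasCount (Decorates (x ∷ a))) (*-comm (weight a) (CP (x ∸ 1)))
      (sumOver-cong (λ { ((g , X) , ((gap , length≡) , (gaps , sizes≡)) , refl) →
                         (gap ∷ gaps) , cong₂ _∷_ (trans (cong suc length≡) (m+[n∸m]≡n 1≤x)) sizes≡ })
                    (split-decoration _)
        (sumOver-image {f = λ _ → 1} (λ p → proj₁ p ∷ proj₂ p) (λ { _ _ refl → refl })
          (sumOver-Σ (sumOver-congᶠ (λ _ → *-identityʳ (weight a)) (sumOver-*ˡ (weight a) (count-gaps (x ∸ 1))))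
                     (λ _ → count-decorations a positive))))
    where
    split-decoration : ∀ X → Decorates (x ∷ a) X → Σ (List Letter × List (List Letter)) λ p →
      (IsGapOfLength (x ∸ 1) (proj₁ p) × Decorates a (proj₂ p)) × (proj₁ p ∷ proj₂ p) ≡ X
    split-decoration (g ∷ X) (gap ∷ gaps , sizes≡) with ∷-injective sizes≡
    ... | size≡ , sizes≡′ = (g , X) , ((gap , cong (_∸ 1) size≡) , (gaps , sizes≡′)) , refl

  NoCS-suffix : ∀ xs ys → NoCS (xs ++ ys) → NoCS ys
  NoCS-suffix [] ys n = n
  NoCS-suffix (x ∷ []) [] n = tt
  NoCS-suffix (x ∷ []) (y ∷ ys) (_ , n) = n
  NoCS-suffix (x ∷ x' ∷ xs) ys (_ , n) = NoCS-suffix (x' ∷ xs) ys n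

  Allowed-¬C : ∀ x y → x ≢ C → Allowed x y
  Allowed-¬C C y ne = ⊥-elim (ne refl)
  Allowed-¬C S y ne = tt
  Allowed-¬C N y ne = tt

  NoCS-NotC-++ : ∀ g rest → All NotC g → NoCS rest → NoCS (g ++ rest)
  NoCS-NotC-++ [] rest _ n = n
  NoCS-NotC-++ (x ∷ []) [] _ n = tt
  NoCS-NotC-++ (x ∷ []) (y ∷ rest) (nx ∷ _) n = Allowed-¬C x y nx , n
  NoCS-NotC-++ (x ∷ x' ∷ g) rest (nx ∷ a) n = Allowed-¬C x x' nx , NoCS-NotC-++ (x' ∷ g) rest a n

  NoCS-C : ∀ rest → NoCS rest → NotStartS rest → NoCS (C ∷ rest)
  NoCS-C [] _ _ = tt
  NoCS-C (C ∷ r) n h = tt , n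
  NoCS-C (S ∷ r) n h = ⊥-elim (h refl)
  NoCS-C (N ∷ r) n h = tt , n

  NoCS-C⁻ : ∀ rest → NoCS (C ∷ rest) → NoCS rest × NotStartS rest
  NoCS-C⁻ [] _ = tt , tt
  NoCS-C⁻ (C ∷ r) (_ , n) = n , λ ()
  NoCS-C⁻ (S ∷ r) (() , n)
  NoCS-C⁻ (N ∷ r) (_ , n) = n , λ ()

  NotStartS-++ : ∀ g rest → NotStartS g → NotStartS rest → NotStartS (g ++ rest)
  NotStartS-++ [] rest _ h = h
  NotStartS-++ (x ∷ g) rest h _ = h

  NotStartS-++⁻ : ∀ g rest → NotStartS (g ++ rest) → NotStartS g
  NotStartS-++⁻ [] rest _ = tt
  NotStartS-++⁻ (x ∷ g) rest h = h

  joinGaps-NoCS : ∀ X T → All IsGap X → NoCS T → NotStartS T → NoCS (joinGaps X ++ T) × NotStartS (joinGaps X ++ T)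
  joinGaps-NoCS [] T _ n h = n , h
  joinGaps-NoCS (g ∷ X) T ((ng , hg) ∷ aX') n h with joinGaps-NoCS X T aX' n h
  ... | n' , h' = subst NoCS (sym (++-assoc g (C ∷ joinGaps X) T)) (NoCS-NotC-++ g (C ∷ joinGaps X ++ T) ng (NoCS-C (joinGaps X ++ T) n' h')) ,
                 subst NotStartS (sym (++-assoc g (C ∷ joinGaps X) T)) (NotStartS-++ g (C ∷ joinGaps X ++ T) hg (λ ()))

  NoCS-take1 : ∀ l → NoCS (take 1 l)
  NoCS-take1 [] = tt
  NoCS-take1 (x ∷ l) = tt

  NotStartS-take1⁻ : ∀ g {r} → NotStartS (take 1 (g ++ r)) → NotStartS g
  NotStartS-take1⁻ []      _ = tt
  NotStartS-take1⁻ (x ∷ g) h = h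

  NotStartS-take1 : ∀ l → NotStartS l → NotStartS (take 1 l)
  NotStartS-take1 [] _ = tt
  NotStartS-take1 (x ∷ l) h = h

  joinGaps-CyclicNoCS : ∀ X → All IsGap X → CyclicNoCS (joinGaps X)
  joinGaps-CyclicNoCS X ag = proj₁ (joinGaps-NoCS X (take 1 (joinGaps X)) ag (NoCS-take1 (joinGaps X))
               (NotStartS-take1 (joinGaps X) (subst NotStartS (++-identityʳ (joinGaps X)) (proj₂ (joinGaps-NoCS X [] ag tt tt)))))

  NoCS-snoc : ∀ l a z → NoCS (l ++ [ a ]) → Allowed a z → NoCS ((l ++ [ a ]) ++ [ z ])
  NoCS-snoc [] a z _ o = o , tt
  NoCS-snoc (x ∷ []) a z (o1 , _) o = o1 , o , tt
  NoCS-snoc (x ∷ x' ∷ l) a z (o1 , n) o = o1 , NoCS-snoc (x' ∷ l) a z n o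

  CyclicNoCS-rot₁ : ∀ w → CyclicNoCS w → CyclicNoCS (rot₁ w)
  CyclicNoCS-rot₁ [] v = tt
  CyclicNoCS-rot₁ (x ∷ []) v = v
  CyclicNoCS-rot₁ (x ∷ y ∷ w) (o , n) = NoCS-snoc (y ∷ w) x y n o

  CyclicNoCS-rot : ∀ p w → CyclicNoCS w → CyclicNoCS (rot p w)
  CyclicNoCS-rot zero w v = v
  CyclicNoCS-rot (suc p) w v = CyclicNoCS-rot p (rot₁ w) (CyclicNoCS-rot₁ w v)

  length-joinGaps : ∀ X → length (joinGaps X) ≡ sum (gapSizes X)
  length-joinGaps [] = refl
  length-joinGaps (g ∷ X) = trans (length-++ g) (trans (+-suc (length g) _) (cong (λ z → suc (length g + z)) (length-joinGaps X)))

  firstC-unique : ∀ P P' Q Q' → All NotC P → All NotC P' → P ++ C ∷ Q ≡ P' ++ C ∷ Q' → P ≡ P' × Q ≡ Q'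
  firstC-unique [] [] Q Q' _ _ e = refl , proj₂ (∷-injective e)
  firstC-unique [] (x ∷ P') Q Q' _ (nx ∷ _) e = ⊥-elim (nx (sym (proj₁ (∷-injective e))))
  firstC-unique (x ∷ P) [] Q Q' (nx ∷ _) _ e = ⊥-elim (nx (proj₁ (∷-injective e)))
  firstC-unique (x ∷ P) (x' ∷ P') Q Q' (_ ∷ a) (_ ∷ a') e with ∷-injective e
  ... | refl , e2 with firstC-unique P P' Q Q' a a' e2
  ...   | refl , refl = refl , refl

  lastC-unique : ∀ A A' B B' → All NotC B → All NotC B' → A ++ C ∷ B ≡ A' ++ C ∷ B' → B ≡ B'
  lastC-unique [] [] B B' _ _ e = proj₂ (∷-injective e)
  lastC-unique [] (x ∷ A') B B' nb _ e = ⊥-elim (All.lookup nb (subst (C ∈_) (sym (proj₂ (∷-injective e))) (∈-++⁺ʳ A' (here refl))) refl)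
  lastC-unique (x ∷ A) [] B B' _ nb' e = ⊥-elim (All.lookup nb' (subst (C ∈_) (proj₂ (∷-injective e)) (∈-++⁺ʳ A (here refl))) refl)
  lastC-unique (x ∷ A) (x' ∷ A') B B' nb nb' e = lastC-unique A A' B B' nb nb' (proj₂ (∷-injective e))

  joinGaps-injective : ∀ X X' → All (All NotC) X → All (All NotC) X' → joinGaps X ≡ joinGaps X' → X ≡ X'
  joinGaps-injective [] [] _ _ _ = refl
  joinGaps-injective [] (g ∷ X') _ _ e = ⊥-elim (nil g e)
    where nil : ∀ g {r} → [] ≢ g ++ C ∷ r
          nil [] ()
          nil (_ ∷ _) ()
  joinGaps-injective (g ∷ X) [] _ _ e = ⊥-elim (nil g e)
    where nil : ∀ g {r} → g ++ C ∷ r ≢ []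
          nil [] ()
          nil (_ ∷ _) ()
  joinGaps-injective (g ∷ X) (g' ∷ X') (a ∷ as) (a' ∷ as') e with firstC-unique g g' (joinGaps X) (joinGaps X') a a' e
  ... | refl , e2 = cong (g ∷_) (joinGaps-injective X X' as as' e2)

  IsGapListOf : ℕ → List (List Letter) → Set
  IsGapListOf m X = All IsGap X × sum (gapSizes X) ≡ m

  -- Rotating by p < (first gap size) leaves the last C followed by the first p letters of the
  -- first gap, which recovers p.
  GapRotation : ℕ → List (List Letter) × ℕ → Set
  GapRotation m (X , p) = IsGapListOf m X × p < head₀ (gapSizes X)

  rotateGaps : List (List Letter) × ℕ → List Letter
  rotateGaps (X , p) = rot p (joinGaps X)

  ∈⇒at : ∀ {x} (w : List Letter) → x ∈ w → Σ ℕ λ r → r < length w × at w r ≡ x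
  ∈⇒at (y ∷ w) (here refl) = 0 , s≤s z≤n , refl
  ∈⇒at (y ∷ w) (there m) with ∈⇒at w m
  ... | r , lt , e = suc r , s≤s lt , e

  rotateGaps-wheelWord : ∀ m x → GapRotation m x → WheelWord m (rotateGaps x) × C ∈ rotateGaps x
  rotateGaps-wheelWord m ([] , p) (_ , ())
  rotateGaps-wheelWord m ((g ∷ X) , p) ((ag , sm) , lt) =
    (trans (length-rot p (joinGaps (g ∷ X))) (trans (length-joinGaps (g ∷ X)) sm) , CyclicNoCS-rot p (joinGaps (g ∷ X)) (joinGaps-CyclicNoCS (g ∷ X) ag) ,
     (λ noC _ → let (r , rl , e) = ∈⇒at (rotateGaps ((g ∷ X) , p)) cin in noC r rl e)) , cin
    where
    cin : C ∈ rotateGaps ((g ∷ X) , p)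
    cin = ∈-resp-↭ (↭-sym (rot-↭ p (joinGaps (g ∷ X)))) (∈-++⁺ʳ g (here refl))

  take-++ : ∀ {A : Set} p (xs ys : List A) → p ≤ length xs → take p (xs ++ ys) ≡ take p xs
  take-++ zero xs ys _ = refl
  take-++ (suc p) (x ∷ xs) ys (s≤s le) = cong (x ∷_) (take-++ p xs ys le)

  drop-++ : ∀ {A : Set} p (xs ys : List A) → p ≤ length xs → drop p (xs ++ ys) ≡ drop p xs ++ ys
  drop-++ zero xs ys _ = refl
  drop-++ (suc p) (x ∷ xs) ys (s≤s le) = drop-++ p xs ys le

  joinGaps-endsC : ∀ h X → Σ (List Letter) λ A → h ++ C ∷ joinGaps X ≡ A ++ [ C ]
  joinGaps-endsC h [] = h , refl
  joinGaps-endsC h (g ∷ X) with joinGaps-endsC (h ++ C ∷ g) X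
  ... | A , e = A , trans (sym (trans (++-assoc h (C ∷ g) (C ∷ joinGaps X)) refl)) e

  rotateGaps-split : ∀ g X p → p ≤ length g → Σ (List Letter) λ A → rotateGaps ((g ∷ X) , p) ≡ A ++ C ∷ take p g
  rotateGaps-split g X p le with joinGaps-endsC (drop p g) X
  ... | A , e = A ,
    trans (rot≡drop++take p (joinGaps (g ∷ X)) (≤-trans le (≤-trans (m≤m+n (length g) _) (≤-reflexive (sym (length-++ g))))))
    (trans (cong₂ _++_ (drop-++ p g (C ∷ joinGaps X) le) (take-++ p g (C ∷ joinGaps X) le))
    (trans (cong (_++ take p g) e) (++-assoc A [ C ] (take p g))))

  rotateGaps-injective : ∀ m x y → GapRotation m x → GapRotation m y → rotateGaps x ≡ rotateGaps y → x ≡ y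
  rotateGaps-injective m ([] , p) _ (_ , ()) _ _
  rotateGaps-injective m _ ([] , p) _ (_ , ()) _
  rotateGaps-injective m ((g ∷ X) , p) ((g' ∷ X') , p') ((ag , _) , lt) ((ag' , _) , lt') e
    with rotateGaps-split g X p (≤-pred lt) | rotateGaps-split g' X' p' (≤-pred lt')
  ... | A , split≡ | A' , split≡′ with lastC-unique A A' (take p g) (take p' g')
                                 (AllP.take⁺ p (proj₁ (All.head ag))) (AllP.take⁺ p' (proj₁ (All.head ag')))
                                 (trans (sym split≡) (trans e split≡′))
  ...   | et with trans (sym (length-take-≤ p g (≤-pred lt))) (trans (cong length et) (length-take-≤ p' g' (≤-pred lt')))
  ...     | refl = cong (_, p) (joinGaps-injective (g ∷ X) (g' ∷ X') (All.map proj₁ ag) (All.map proj₁ ag')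
                           (rot-injective p (joinGaps (g ∷ X)) (joinGaps (g' ∷ X')) e))


  lastC-split : ∀ w → C ∈ w → Σ (List Letter) λ A → Σ (List Letter) λ B → w ≡ A ++ C ∷ B × All NotC B
  lastC-split (x ∷ w) m with C ∈? w
  ... | yes m' with lastC-split w m'
  ...   | A , B , e , nb = x ∷ A , B , cong (x ∷_) e , nb
  lastC-split (x ∷ w) (here refl) | no nm = [] , w , refl , All.tabulate (λ {y} y∈ e → nm (subst (_∈ w) e y∈))
  lastC-split (x ∷ w) (there m) | no nm = ⊥-elim (nm m)

  splitAtC : ∀ u → Σ (List (List Letter)) λ X → Σ (List Letter) λ Rr → u ≡ joinGaps X ++ Rr × All (All NotC) X × All NotC Rr
  splitAtC [] = [] , [] , refl , [] , []
  splitAtC (x ∷ u) with splitAtC u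
  ... | X , Rr , e , nX , nR with x ≟L C
  ...   | yes refl = [] ∷ X , Rr , cong (C ∷_) e , [] ∷ nX , nR
  ...   | no nx with X
  ...     | [] = [] , x ∷ Rr , cong (x ∷_) e , [] , nx ∷ nR
  ...     | g ∷ X' with nX
  ...       | ng ∷ nX' = (x ∷ g) ∷ X' , Rr , cong (x ∷_) e , (nx ∷ ng) ∷ nX' , nR

  ++-∷-≢[] : ∀ (xs : List Letter) {x ys} → xs ++ x ∷ ys ≢ []
  ++-∷-≢[] []      ()
  ++-∷-≢[] (_ ∷ _) ()

  lastIn : ∀ (xs ys zs : List Letter) c → xs ++ ys ≡ zs ++ [ c ] → ys ≢ [] → c ∈ ys
  lastIn [] ys zs c e ne = subst (c ∈_) (sym e) (∈-++⁺ʳ zs (here refl))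
  lastIn (x ∷ xs) ys [] c e ne with ∷-injective e
  ... | _ , e2 = ⊥-elim (ne (Data.List.Properties.++-conicalʳ xs ys e2))
    where import Data.List.Properties
  lastIn (x ∷ xs) ys (z ∷ zs) c e ne = lastIn xs ys zs c (proj₂ (∷-injective e)) ne

  NoCS-joinGaps⁻ : ∀ g X T → All NotC g → All (All NotC) X → NoCS (g ++ C ∷ joinGaps X ++ T) → All NotStartS X × NotStartS T
  NoCS-joinGaps⁻ g X T ng nX n with NoCS-C⁻ (joinGaps X ++ T) (NoCS-suffix g (C ∷ joinGaps X ++ T) n)
  NoCS-joinGaps⁻ g [] T ng nX n | n' , h = [] , h
  NoCS-joinGaps⁻ g (g' ∷ X) T ng (ng' ∷ nX) n | n' , h with NoCS-joinGaps⁻ g' X T ng' nX (subst NoCS (++-assoc g' (C ∷ joinGaps X) T) n')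
  ... | hX , hT = NotStartS-++⁻ g' (C ∷ joinGaps X ++ T) (subst NotStartS (++-assoc g' (C ∷ joinGaps X) T) h) ∷ hX , hT

  prefix-length-≤ : ∀ (B g r r' : List Letter) → All NotC B → All NotC g → B ++ r ≡ g ++ C ∷ r' → length B ≤ length g
  prefix-length-≤ [] g r r' _ _ _ = z≤n
  prefix-length-≤ (b ∷ B) [] r r' (nb ∷ _) _ e = ⊥-elim (nb (proj₁ (∷-injective e)))
  prefix-length-≤ (b ∷ B) (x ∷ g) r r' (_ ∷ nB) (_ ∷ ng) e = s≤s (prefix-length-≤ B g r r' nB ng (proj₂ (∷-injective e)))

  gapsOf : ∀ u {A} → u ≡ A ++ [ C ] → CyclicNoCS u → Σ (List (List Letter)) λ X → u ≡ joinGaps X × All IsGap X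
  gapsOf u {A} u≡ cyc with splitAtC u
  ... | X , r ∷ R , u≡′ , _ , notC =
    ⊥-elim (All.lookup notC (lastIn (joinGaps X) (r ∷ R) A C (trans (sym u≡′) u≡) (λ ())) refl)
  ... | [] , [] , u≡′ , _ , _ = ⊥-elim (++-∷-≢[] A (trans (sym u≡) u≡′))
  ... | g ∷ X , [] , u≡′ , notC-g ∷ notC-X , _ =
    g ∷ X , u≡ᵍ , (notC-g , NotStartS-take1⁻ g (proj₂ starts)) ∷ zipGaps notC-X (proj₁ starts)
    where
    u≡ᵍ : u ≡ joinGaps (g ∷ X)
    u≡ᵍ = trans u≡′ (++-identityʳ _)
    T = take 1 (joinGaps (g ∷ X))
    starts : All NotStartS X × NotStartS T
    starts = NoCS-joinGaps⁻ g X T notC-g notC-X (subst NoCS (++-assoc g (C ∷ joinGaps X) T) (subst CyclicNoCS u≡ᵍ cyc))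
    zipGaps : ∀ {Y} → All (All NotC) Y → All NotStartS Y → All IsGap Y
    zipGaps []       []       = []
    zipGaps (a ∷ as) (h ∷ hs) = (a , h) ∷ zipGaps as hs

  rotateGaps-surjective : ∀ m w → WheelWord m w → C ∈ w → Σ (List (List Letter) × ℕ) λ x → GapRotation m x × rotateGaps x ≡ w
  rotateGaps-surjective m w (length≡ , cyc , _) C∈w with lastC-split w C∈w
  ... | A , B , w≡ , notC-B with gapsOf (B ++ A ++ [ C ]) (sym (++-assoc B A [ C ])) cyc-u
    where
    cyc-u : CyclicNoCS (B ++ A ++ [ C ])
    cyc-u = subst CyclicNoCS (rot-++ (A ++ [ C ]) B)
              (CyclicNoCS-rot (length (A ++ [ C ])) ((A ++ [ C ]) ++ B) (subst CyclicNoCS (trans w≡ (sym (++-assoc A [ C ] B))) cyc))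
  ... | [] , u≡ , _ = ⊥-elim (++-∷-≢[] (B ++ A) (trans (++-assoc B A [ C ]) u≡))
  ... | g ∷ X , u≡ , gaps =
    (g ∷ X , length B) , ((gaps , sum≡) , s≤s (prefix-length-≤ B g (A ++ [ C ]) (joinGaps X) notC-B (proj₁ (All.head gaps)) u≡)) ,
    trans (cong (rot (length B)) (sym u≡)) rot≡w
    where
    rot≡w : rot (length B) (B ++ A ++ [ C ]) ≡ w
    rot≡w = trans (rot-++ B (A ++ [ C ])) (trans (++-assoc A [ C ] B) (sym w≡))
    sum≡ : sum (gapSizes (g ∷ X)) ≡ m
    sum≡ = trans (sym (length-joinGaps (g ∷ X)))
             (trans (cong length (sym u≡)) (trans (sym (length-rot (length B) _)) (trans (cong length rot≡w) length≡)))

  sumOver-gapLists : ∀ {m s} → SumOver (IsCompositionℕ m) (λ a → head₀ a * weight a) s →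
                     SumOver (IsGapListOf m) (λ X → head₀ (gapSizes X)) s
  sumOver-gapLists {m} sum-compositions =
    sumOver-cong (λ { ((_ , X) , ((_ , sum≡) , (gaps , sizes≡)) , refl) → gaps , trans (cong sum sizes≡) sum≡ })
                 (λ { {X} (gaps , sum≡) → (gapSizes X , X) , ((sizes-positive X , sum≡) , (gaps , refl)) , refl })
      (sumOver-image proj₂ (λ { {_ , X} (_ , (_ , sizes≡)) (_ , (_ , sizes≡′)) refl → cong (_, X) (trans (sym sizes≡) sizes≡′) })
        (sumOver-congᶠ (λ { (_ , (_ , sizes≡)) → cong head₀ (sym sizes≡) })
          (sumOver-Σ sum-compositions λ {a} (positive , _) →
            sumOver-congᶠ (λ _ → *-identityʳ (head₀ a)) (sumOver-*ˡ (head₀ a) (count-decorations a positive)))))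
    where
    sizes-positive : ∀ X → All (λ x → 1 ≤ x) (gapSizes X)
    sizes-positive []      = []
    sizes-positive (g ∷ X) = s≤s z≤n ∷ sizes-positive X

  count-words-with-C : ∀ {m s} → SumOver (IsCompositionℕ m) (λ a → head₀ a * weight a) s →
                       HasCount (λ w → WheelWord m w × C ∈ w) s
  count-words-with-C {m} sum-compositions =
    sumOver-cong (λ { (x , Rx , refl) → rotateGaps-wheelWord m x Rx }) (λ (ww , C∈) → rotateGaps-surjective m _ ww C∈)
      (sumOver-image {f = λ _ → 1} rotateGaps (rotateGaps-injective m _ _)
        (sumOver-Σ (sumOver-gapLists sum-compositions) (λ {X} _ → count-< (head₀ (gapSizes X)))))

  NoCS-NotC : ∀ l → All NotC l → NoCS l
  NoCS-NotC [] _ = tt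
  NoCS-NotC (x ∷ []) _ = tt
  NoCS-NotC (x ∷ y ∷ l) (nx ∷ a) = Allowed-¬C x y nx , NoCS-NotC (y ∷ l) a

  count-wheelWords : ∀ {m s} → SumOver (IsCompositionℕ m) (λ a → head₀ a * weight a) s →
                     HasCount (WheelWord m) ((2 ^ m ∸ m) + s)
  count-wheelWords {m} sum-compositions =
    sumOver-cong C-free⊎with-C⇒WheelWord WheelWord⇒C-free⊎with-C
      (sumOver-⊎ (λ ((_ , notC) , _) (_ , C∈) → All.lookup notC C∈ refl)
        (count-SNWords-NotLoneN m) (count-words-with-C sum-compositions))
    where
    C-free⊎with-C⇒WheelWord : ∀ {w} → (IsSNWord m w × countN w ≢ 1) ⊎ (WheelWord m w × C ∈ w) → WheelWord m w
    C-free⊎with-C⇒WheelWord {w} (inj₁ ((length≡ , notC) , count≢1)) =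
      length≡ , NoCS-NotC (w ++ take 1 w) (AllP.++⁺ notC (AllP.take⁺ 1 notC)) , λ _ → count≢1
    C-free⊎with-C⇒WheelWord (inj₂ (ww , _)) = ww
    WheelWord⇒C-free⊎with-C : ∀ {w} → WheelWord m w → (IsSNWord m w × countN w ≢ 1) ⊎ (WheelWord m w × C ∈ w)
    WheelWord⇒C-free⊎with-C {w} ww@(length≡ , _ , lone) with C ∈? w
    ... | yes C∈w = inj₂ (ww , C∈w)
    ... | no  C∉w = inj₁ ((length≡ , notC) , lone (λ r r< → All.lookup notC (at-∈ w r r<)))
      where
      notC : All NotC w
      notC = All.tabulate (λ {x} x∈ x≡C → C∉w (subst (_∈ w) x≡C x∈))



open import Data.Nat using (ℕ; zero; suc; _+_; _*_; _∸_; _^_; _≤_; _<_; z≤n; s≤s)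
open import Data.Nat.Properties using (+-suc; +-comm; +-∸-assoc; ≤-pred; ≤-trans; ≤-reflexive; +-mono-<-≤; +-identityʳ)
open import Data.Nat.Divisibility using (_∣_)
open import Data.List using (map)
open import Data.Nat.ListAction using (product)
open import Data.Product using (_×_)
open import Relation.Binary.PropositionalEquality using (_≡_; subst; cong; trans; sym)
open import Defs
open LyndonWords
open WheelCodes
open Counting

m<2^m : ∀ m → m < 2 ^ m
m<2^m zero    = s≤s z≤n
m<2^m (suc m) = subst (_< 2 ^ suc m) (+-comm m 1)
  (≤-trans (+-mono-<-≤ (m<2^m m) (≤-trans (s≤s z≤n) (m<2^m m))) (≤-reflexive (cong (2 ^ m +_) (sym (+-identityʳ (2 ^ m))))))

∸-+-rearrange : ∀ {a m} t → m < a → (a ∸ m) + suc t ≡ (a ∸ suc m) + 2 + t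
∸-+-rearrange {suc a} {m} t m<a =
  trans (cong (_+ suc t) (+-∸-assoc 1 (≤-pred m<a)))
        (trans (cong suc (+-suc (a ∸ m) t)) (sym (cong (_+ t) (+-comm (a ∸ m) 2))))

theorem8 : (n : ℕ) → 2 ≤ n →
    (s : ℕ → ℕ) →
    (∀ d q → d * q ≡ n ∸ 1 → 1 < d →
       SumOver (IsLyndonComposition d)
               (λ a → product (map CP (map (λ x → x ∸ 1) a)) ^ q) (s d)) →
    (t : ℕ) →
    SumOver (λ d → (d ∣ n ∸ 1) × (1 < d)) (λ d → d * s d) t →
    HasCount (IsComposition n (WheelAdj n)) (((2 ^ (n ∸ 1)) ∸ n) + 2 + t)
theorem8 (suc zero)    (s≤s ())
theorem8 (suc (suc k)) _ s sum-lyndon t sum-divisors =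
  subst (HasCount (IsComposition (suc m) (WheelAdj (suc m)))) (∸-+-rearrange t (m<2^m m))
    (count-compositions m (count-wheelWords (sumOver-head-weight (s≤s z≤n) s sum-lyndon sum-divisors)))
  where
  m = suc k
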